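{- Let $\mathcal D$ be the convolution subalgebra of $\hat{\mathcal T}=\prod_{S\in\mathcal P}\mathcal T_S$ generated by the elements $1_n=\sum_{S\in\mathcal P,\,|S|=n}1_S$, $n\in\mathbf N$. Then $\mathcal D$ is also a subalgebra of $\hat{\mathcal T}$ for the composition product $\circ$. More precisely, each component $\mathcal D_n:=\mathcal D\cap\prod_{|S|=n}\mathcal T_S$ is closed under $\circ$, and $(\mathcal D_n,\circ)$ is isomorphic to Solomon's descent algebra of the symmetric group $S_n$.
   Context: Let $\mathbf k$ be a field, $\mathbf N$ the positive integers and $\mathcal P$ the set of finite subsets of $\mathbf N$. $\mathcal T$ is the $\mathbf k$-vector space with basis the symbols $1_{(S_1,\dots,S_k)}$, $k\ge0$, with $S_i\in\mathcal P$ nonempty and pairwise disjoint ($1_\emptyset$ for the empty sequence; a symbol with empty entries means the same symbol with them deleted); $\mathcal T_S$ is the span of those with $S_1\cup\cdots\cup S_k=S$. Products on basis elements: $1_{(S_1,\dots,S_n)}\ast 1_{(T_1,\dots,T_k)}=1_{(S_1,\dots,S_n,T_1,\dots,T_k)}$ if $(\bigcup S_i)\cap(\bigcup T_j)=\emptyset$, else $0$; $1_{(S_1,\dots,S_n)}\circ 1_{(T_1,\dots,T_k)}=0$ if $\bigcup S_i\neq\bigcup T_j$, else $1_{(S_1\cap T_1,\dots,S_1\cap T_k,\dots,S_n\cap T_1,\dots,S_n\cap T_k)}$. Both products extend to $\hat{\mathcal T}=\prod_S\mathcal T_S$ (each component of a product involves only finitely many terms; $\circ$ acts componentwise). Solomon's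 descent algebra of $S_n$: for a composition $C=(n_1,\dots,n_k)$ of $n$, let $D_C\in\mathbf k[S_n]$ be the sum of all permutations $\sigma\in S_n$ whose descent set $\{i:\sigma(i)>\sigma(i+1)\}$ is contained in $\{n_1,n_1+n_2,\dots,n_1+\cdots+n_{k-1}\}$; the descent algebra is the subalgebra of the group algebra $\mathbf k[S_n]$ spanned by the $D_C$. -}

module Defs where

open import Level using (_⊔_) renaming (suc to lsuc)
open import Algebra.Bundles using (CommutativeRing)
open import Data.Nat as ℕ using (ℕ; zero; suc; _≤_; _<_; _≤ᵇ_; _<ᵇ_; _≡ᵇ_)
open import Data.Bool using (Bool; true; false; if_then_else_; not)
open import Data.List
  using (List; []; _∷_; [_]; map; concatMap; concat; length; take; drop; foldr;
         upTo; null; filterᵇ)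
open import Data.Bool.ListAction using (all; any)
open import Data.Nat.ListAction using (sum)
import Data.List.Properties as LP
open import Data.List.Relation.Unary.All using (All)
open import Data.List.Relation.Unary.Linked using (Linked)
open import Data.List.Relation.Unary.Unique.Propositional using (Unique)
open import Data.List.Membership.Propositional using (_∈_)
open import Data.Product using (Σ; _×_; _,_)
open import Relation.Nullary using (¬_)
open import Relation.Nullary.Decidable using (⌊_⌋)
open import Relation.Binary.PropositionalEquality using (_≡_)

record Field c ℓ : Set (lsuc (c ⊔ ℓ)) where
  field
    commutativeRing : CommutativeRing c ℓ
  open CommutativeRing commutativeRing public
  field
    1≉0     : ¬ (1# ≈ 0#)
    inverse : ∀ x → ¬ (x ≈ 0#) → Σ Carrier λ y → x * y ≈ 1#

memB : ℕ → List ℕ → Bool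
memB x = any (x ≡ᵇ_)

eqSC : List (List ℕ) → List (List ℕ) → Bool
eqSC u v = ⌊ LP.≡-dec (LP.≡-dec ℕ._≟_) u v ⌋

-- Finite subsets of N = {1,2,...} are represented canonically as strictly
-- increasing lists of positive naturals.
IsFinSet : List ℕ → Set
IsFinSet S = Linked _<_ S × All (1 ≤_) S

-- A basis symbol 1_(S_1,...,S_k) is represented by the list [S_1,...,S_k].
-- It is valid when the S_i are nonempty finite subsets of N, pairwise disjoint.
ValidSC : List (List ℕ) → Set
ValidSC w = All (λ S → ¬ (S ≡ []) × IsFinSet S) w × Unique (concat w)

size : List (List ℕ) → ℕ
size w = sum (map length w)

insertℕ : ℕ → List ℕ → List ℕ
insertℕ x [] = x ∷ []
insertℕ x (y ∷ ys) = if x ≤ᵇ y then x ∷ y ∷ ys else y ∷ insertℕ x ys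

isort : List ℕ → List ℕ
isort = foldr insertℕ []

splits : List ℕ → List (List ℕ × List ℕ)
splits [] = ([] , []) ∷ []
splits (x ∷ xs) = concatMap (λ { (a , b) → (x ∷ a , b) ∷ (a , x ∷ b) ∷ [] }) (splits xs)

setCompsF : ℕ → List ℕ → List (List (List ℕ))
setCompsF _ [] = [] ∷ []
setCompsF zero (_ ∷ _) = []
setCompsF (suc k) (x ∷ xs) =
  concatMap (λ { (a , b) → if null a then [] else map (a ∷_) (setCompsF k b) })
            (splits (x ∷ xs))

setComps : List ℕ → List (List (List ℕ))
setComps s = setCompsF (length s) s

inter : List ℕ → List ℕ → List ℕ
inter S T = filterᵇ (λ x → memB x T) S

meet : List (List ℕ) → List (List ℕ) → List (List ℕ)
meet u v = filterᵇ (λ S → not (null S)) (concatMap (λ S → map (inter S) v) u)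

-- permutations of S_n in one-line notation [σ(1),...,σ(n)]
insertAll : ℕ → List ℕ → List (List ℕ)
insertAll x [] = (x ∷ []) ∷ []
insertAll x (y ∷ ys) = (x ∷ y ∷ ys) ∷ map (y ∷_) (insertAll x ys)

perms : List ℕ → List (List ℕ)
perms [] = [] ∷ []
perms (x ∷ xs) = concatMap (insertAll x) (perms xs)

allPerms : ℕ → List (List ℕ)
allPerms n = perms (map suc (upTo n))

-- σ(i) for 1-based i
at1 : List ℕ → ℕ → ℕ
at1 [] _ = 0
at1 (x ∷ xs) zero = 0
at1 (x ∷ xs) (suc zero) = x
at1 (x ∷ xs) (suc (suc k)) = at1 xs (suc k)

-- product in S_n, composing left to right: (σ · τ)(i) = τ(σ(i))
mulPerm : List ℕ → List ℕ → List ℕ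
mulPerm σ τ = map (at1 τ) σ

descentsFrom : ℕ → List ℕ → List ℕ
descentsFrom i [] = []
descentsFrom i (x ∷ []) = []
descentsFrom i (x ∷ y ∷ r) =
  if y <ᵇ x then i ∷ descentsFrom (suc i) (y ∷ r) else descentsFrom (suc i) (y ∷ r)

descents : List ℕ → List ℕ
descents = descentsFrom 1

partialSumsFrom : ℕ → List ℕ → List ℕ
partialSumsFrom acc [] = []
partialSumsFrom acc (x ∷ []) = []
partialSumsFrom acc (x ∷ y ∷ r) = (acc ℕ.+ x) ∷ partialSumsFrom (acc ℕ.+ x) (y ∷ r)

partialSums : List ℕ → List ℕ
partialSums = partialSumsFrom 0

IsComposition : ℕ → List ℕ → Set
IsComposition n C = All (1 ≤_) C × sum C ≡ n

module Construction {c ℓ} (F : Field c ℓ) where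
  open Field F

  bool : Bool → Carrier
  bool true = 1#
  bool false = 0#

  sumL : List Carrier → Carrier
  sumL = foldr _+_ 0#

  -- elements of T̂ = ∏_S T_S : coefficient functions on basis symbols
  -- (only values at valid symbols matter, see _≐_)
  T̂ : Set c
  T̂ = List (List ℕ) → Carrier

  _≐_ : T̂ → T̂ → Set (ℓ)
  f ≐ g = ∀ w → ValidSC w → f w ≈ g w

  _⊕_ : T̂ → T̂ → T̂
  (f ⊕ g) w = f w + g w

  _·_ : Carrier → T̂ → T̂
  (a · f) w = a * f w

  _∗_ : T̂ → T̂ → T̂
  (f ∗ g) w = sumL (map (λ i → f (take i w) * g (drop i w)) (upTo (suc (length w))))

  _∘_ : T̂ → T̂ → T̂
  (f ∘ g) w =
    let U = isort (concat w) in
    sumL (concatMap (λ u → map (λ v → if eqSC (meet u v) w then f u * g v else 0#)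
                               (setComps U))
                    (setComps U))

  one∅ : T̂
  one∅ w = bool (null w)

  oneN : ℕ → T̂
  oneN n [] = 0#
  oneN n (S ∷ []) = bool (length S ≡ᵇ n)
  oneN n (_ ∷ _ ∷ _) = 0#

  data InD : T̂ → Set (c ⊔ ℓ) where
    unitD : InD one∅
    genD  : ∀ n → 1 ≤ n → InD (oneN n)
    addD  : ∀ {f g} → InD f → InD g → InD (f ⊕ g)
    scalD : ∀ a {f} → InD f → InD (a · f)
    mulD  : ∀ {f g} → InD f → InD g → InD (f ∗ g)
    respD : ∀ {f g} → f ≐ g → InD f → InD g

  InDn : ℕ → T̂ → Set (c ⊔ ℓ)
  InDn n f = InD f × (∀ w → ValidSC w → ¬ (size w ≡ n) → f w ≈ 0#)

  -- the group algebra k[S_n]: coefficient functions on permutations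
  KS : Set c
  KS = List ℕ → Carrier

  EqP : ℕ → KS → KS → Set ℓ
  EqP n a b = ∀ σ → σ ∈ allPerms n → a σ ≈ b σ

  _⊕ₚ_ : KS → KS → KS
  (a ⊕ₚ b) σ = a σ + b σ

  _·ₚ_ : Carrier → KS → KS
  (x ·ₚ a) σ = x * a σ

  mulKS : ℕ → KS → KS → KS
  mulKS n a b π =
    sumL (concatMap (λ σ → map (λ τ → if eqSC (map [_] (mulPerm σ τ)) (map [_] π)
                                      then a σ * b τ else 0#)
                               (allPerms n))
                    (allPerms n))

  DC : List ℕ → KS
  DC C σ = bool (all (λ i → memB i (partialSums C)) (descents σ))

  data InDesc (n : ℕ) : KS → Set (c ⊔ ℓ) where
    genC  : ∀ C → IsComposition n C → InDesc n (DC C)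
    zeroC : InDesc n (λ _ → 0#)
    addC  : ∀ {a b} → InDesc n a → InDesc n b → InDesc n (a ⊕ₚ b)
    scalC : ∀ x {a} → InDesc n a → InDesc n (x ·ₚ a)
    respC : ∀ {a b} → EqP n a b → InDesc n a → InDesc n b

  record IsDescentIso (n : ℕ) (φ : T̂ → KS) : Set (c ⊔ ℓ) where
    field
      wellDefined  : ∀ f g → InDn n f → InDn n g → f ≐ g → EqP n (φ f) (φ g)
      intoDesc     : ∀ f → InDn n f → InDesc n (φ f)
      additive     : ∀ f g → InDn n f → InDn n g → EqP n (φ (f ⊕ g)) (φ f ⊕ₚ φ g)
      homogeneous  : ∀ a f → InDn n f → EqP n (φ (a · f)) (a ·ₚ φ f)
      multiplicative : ∀ f g → InDn n f → InDn n g →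
                       EqP n (φ (f ∘ g)) (mulKS n (φ f) (φ g))
      injective    : ∀ f g → InDn n f → InDn n g → EqP n (φ f) (φ g) → f ≐ g
      surjective   : ∀ a → InDesc n a → Σ T̂ λ f → InDn n f × EqP n (φ f) a

-- Every element of 𝒟 is a finite linear combination of the indicators 1_K of types
-- (sequences of block sizes), 1_K = 1_{k₁} ∗ ⋯ ∗ 1_{kₘ}. For f, g ∈ 𝒟 the value (f ∘ g)(w) is
-- a sum over pairs of set compositions of the support of w whose meet is w; relabelling the
-- support, first by its increasing enumeration and then by a permutation, shows that it
-- depends only on the type of w, and it vanishes beyond the sizes where f lives, so f ∘ g is
-- again a finite combination of the 1_K.
--
-- The isomorphism sends f ∈ 𝒟_n to Σ_u f(u) · π(u) over the set compositions u of [n],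
-- where π(u) is the permutation read off u block by block. It sends 1_K to Solomon's D_K,
-- since cutting π according to K gives increasing blocks exactly when the descents of π
-- are partial sums of K. It is multiplicative because the reading of meet(u, v) is the
-- product of the readings of u and v once u is relabelled by the reading of v, and it is
-- injective by triangularity: the set composition of type K into decreasing blocks is the
-- only one with its reading word that has at most as many blocks as K.

module Submission where

open import Algebra.Bundles using (Semiring)
open import Data.Bool using (Bool; true; false; not; if_then_else_; T; _∧_)
open import Data.Bool.ListAction using (all)
open import Data.Bool.Properties using (∧-conicalˡ; ∧-conicalʳ; ∧-identityʳ; not-involutive)
open import Data.Empty using (⊥; ⊥-elim)
open import Data.List using (List; []; _∷_; [_]; _++_; map; concat; concatMap; length; filterᵇ; upTo; applyUpTo; take; drop; null; foldr)
import Data.List.Properties as Listₚ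
open import Data.List.Membership.Propositional using (_∈_; _∉_)
import Data.List.Membership.Propositional.Properties as ∈ₚ
open import Data.List.Relation.Binary.Permutation.Propositional using (_↭_; ↭-refl; ↭-sym; ↭-trans; ↭-reflexive; prep; ↭⇒↭ₛ; ↭⇒↭ₛ′; module PermutationReasoning) renaming (swap to ↭-swap)
import Data.List.Relation.Binary.Permutation.Propositional.Properties as ↭ₚ
import Data.List.Relation.Binary.Permutation.Setoid.Properties as ↭ₛ
open import Data.List.Relation.Binary.Subset.Propositional using (_⊆_)
open import Data.List.Relation.Unary.All as All using (All; []; _∷_)
import Data.List.Relation.Unary.All.Properties as Allₚ
open import Data.List.Relation.Unary.AllPairs as AllPairs using (AllPairs; []; _∷_)
import Data.List.Relation.Unary.AllPairs.Properties as AllPairsₚ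
open import Data.List.Relation.Unary.Any as Any using (here; there; any?)
open import Data.List.Relation.Unary.Linked using (Linked; []; [-]; _∷_)
import Data.List.Relation.Unary.Linked.Properties as Linkedₚ
open import Data.List.Relation.Unary.Unique.Propositional using (Unique)
import Data.List.Relation.Unary.Unique.Propositional.Properties as Uniqueₚ
open import Data.Nat as ℕ using (ℕ; zero; suc; _<_; _≤_; z≤n; s≤s; _≡ᵇ_)
open import Data.Nat.ListAction using (sum)
import Data.Nat.Properties as ℕₚ
open import Data.Product using (Σ; ∃; _×_; _,_; proj₁; proj₂)
open import Data.Sum using (_⊎_; inj₁; inj₂; [_,_]′)
open import Level using (Level)
open import Relation.Binary using (tri<; tri≈; tri>; DecidableEquality)
open import Relation.Binary.PropositionalEquality as ≡ using (_≡_; _≢_; refl; sym; trans; cong; cong₂; subst; subst₂)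
open import Relation.Nullary using (¬_; Dec; yes; no; contradiction)
open import Relation.Nullary.Decidable using (⌊_⌋; T?; _×-dec_)

open import Defs

private variable
  la lb : Level
  A : Set la
  B : Set lb

≡ᵇ-refl : ∀ x → (x ≡ᵇ x) ≡ true
≡ᵇ-refl zero = refl
≡ᵇ-refl (suc x) = ≡ᵇ-refl x

≡ᵇ-true⇒≡ : ∀ x y → (x ≡ᵇ y) ≡ true → x ≡ y
≡ᵇ-true⇒≡ zero zero _ = refl
≡ᵇ-true⇒≡ (suc x) (suc y) e = cong suc (≡ᵇ-true⇒≡ x y e)

≢⇒≡ᵇ-false : ∀ x y → x ≢ y → (x ≡ᵇ y) ≡ false
≢⇒≡ᵇ-false x y x≢y with x ≡ᵇ y in eq
... | true = ⊥-elim (x≢y (≡ᵇ-true⇒≡ x y eq))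
... | false = refl

memB⇒∈ : ∀ {x} T → memB x T ≡ true → x ∈ T
memB⇒∈ {x} (y ∷ T) e with x ≡ᵇ y in eq
... | true = here (≡ᵇ-true⇒≡ x y eq)
... | false = there (memB⇒∈ T e)

∈⇒memB : ∀ {x T} → x ∈ T → memB x T ≡ true
∈⇒memB {x} (here refl) rewrite ≡ᵇ-refl x = refl
∈⇒memB {x} {y ∷ T} (there p) with x ≡ᵇ y
... | true = refl
... | false = ∈⇒memB p

memB-false⇒∉ : ∀ {x T} → memB x T ≡ false → x ∉ T
memB-false⇒∉ e m with trans (sym (∈⇒memB m)) e
... | ()

∉⇒memB-false : ∀ {x T} → x ∉ T → memB x T ≡ false
∉⇒memB-false {x} {T} x∉T with memB x T in eq
... | true = ⊥-elim (x∉T (memB⇒∈ T eq))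
... | false = refl

∈-filterᵇ⁻ : (p : A → Bool) → ∀ {x} xs → x ∈ filterᵇ p xs → x ∈ xs × p x ≡ true
∈-filterᵇ⁻ p (y ∷ xs) m with p y in eq
∈-filterᵇ⁻ p (y ∷ xs) (here refl) | true = here refl , eq
∈-filterᵇ⁻ p (y ∷ xs) (there m) | true = let a , b = ∈-filterᵇ⁻ p xs m in there a , b
... | false = let a , b = ∈-filterᵇ⁻ p xs m in there a , b

∈-filterᵇ⁺ : (p : A → Bool) → ∀ {x xs} → x ∈ xs → p x ≡ true → x ∈ filterᵇ p xs
∈-filterᵇ⁺ p {x} {y ∷ xs} (here refl) e rewrite e = here refl
∈-filterᵇ⁺ p {x} {y ∷ xs} (there m) e with p y
... | true = there (∈-filterᵇ⁺ p m e)
... | false = ∈-filterᵇ⁺ p m e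

filterᵇ-cong-local : (p q : A → Bool) → ∀ xs → (∀ x → x ∈ xs → p x ≡ q x) → filterᵇ p xs ≡ filterᵇ q xs
filterᵇ-cong-local p q [] h = refl
filterᵇ-cong-local p q (x ∷ xs) h rewrite h x (here refl) with q x
... | true = cong (x ∷_) (filterᵇ-cong-local p q xs (λ y m → h y (there m)))
... | false = filterᵇ-cong-local p q xs (λ y m → h y (there m))

filterᵇ-map : (p : B → Bool) (f : A → B) → ∀ xs → filterᵇ p (map f xs) ≡ map f (filterᵇ (λ x → p (f x)) xs)
filterᵇ-map p f [] = refl
filterᵇ-map p f (x ∷ xs) with p (f x)
... | true = cong (f x ∷_) (filterᵇ-map p f xs)
... | false = filterᵇ-map p f xs

AllPairs-filterᵇ : ∀ {r} {R : A → A → Set r} (p : A → Bool) {xs} → AllPairs R xs → AllPairs R (filterᵇ p xs)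
AllPairs-filterᵇ p = AllPairsₚ.filter⁺ (λ x → T? (p x))

length-filterᵇ< : (p : A → Bool) → ∀ {x} xs → x ∈ xs → p x ≡ false → length (filterᵇ p xs) < length xs
length-filterᵇ< p xs m e = Listₚ.filter-notAll _ xs (Any.map (λ { refl → subst T e }) m)

∈-tail-≢ : ∀ {z x : A} {xs} → z ∈ x ∷ xs → z ≢ x → z ∈ xs
∈-tail-≢ (here refl) z≢x = ⊥-elim (z≢x refl)
∈-tail-≢ (there m) _ = m

Increasing : List ℕ → Set
Increasing = AllPairs _<_

Increasing⇒Unique : ∀ {xs} → Increasing xs → Unique xs
Increasing⇒Unique = AllPairs.map ℕₚ.<⇒≢

∷-⊆-∷⁻ : ∀ {x xs ys} → All (x <_) xs → x ∷ xs ⊆ x ∷ ys → xs ⊆ ys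
∷-⊆-∷⁻ x< h m = ∈-tail-≢ (h (there m)) (λ { refl → ℕₚ.<-irrefl refl (All.lookup x< m) })

Increasing-ext : ∀ {xs ys} → Increasing xs → Increasing ys → xs ⊆ ys → ys ⊆ xs → xs ≡ ys
Increasing-ext {[]} {[]} _ _ _ _ = refl
Increasing-ext {[]} {y ∷ ys} _ _ _ ys⊆xs with () ← ys⊆xs (here refl)
Increasing-ext {x ∷ xs} {[]} _ _ xs⊆ys _ with () ← xs⊆ys (here refl)
Increasing-ext {x ∷ xs} {y ∷ ys} (x< ∷ sx) (y< ∷ sy) xs⊆ys ys⊆xs
  with xs⊆ys (here refl) | ys⊆xs (here refl)
... | here refl | _ = cong (x ∷_) (Increasing-ext sx sy (∷-⊆-∷⁻ x< xs⊆ys) (∷-⊆-∷⁻ y< ys⊆xs))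
... | there _ | here refl = cong (y ∷_) (Increasing-ext sx sy (∷-⊆-∷⁻ x< xs⊆ys) (∷-⊆-∷⁻ y< ys⊆xs))
... | there x∈ys | there y∈xs = ⊥-elim (ℕₚ.<-asym (All.lookup y< x∈ys) (All.lookup x< y∈xs))

Unique-head : ∀ {x : A} {xs} → Unique (x ∷ xs) → x ∉ xs
Unique-head (x∉ ∷ _) m = All.lookup x∉ m refl

Unique-tail : ∀ {x : A} {xs} → Unique (x ∷ xs) → Unique xs
Unique-tail (_ ∷ u) = u

Unique-↭ : ∀ {xs ys : List A} → xs ↭ ys → Unique xs → Unique ys
Unique-↭ {A = A} p = ↭ₛ.Unique-resp-↭ (≡.setoid A) (↭⇒↭ₛ p)

Unique-ext-↭ : ∀ {xs ys : List A} → Unique xs → Unique ys → xs ⊆ ys → ys ⊆ xs → xs ↭ ys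
Unique-ext-↭ {xs = []} {[]} _ _ _ _ = ↭-refl
Unique-ext-↭ {xs = []} {y ∷ ys} _ _ _ ys⊆xs with () ← ys⊆xs (here refl)
Unique-ext-↭ {xs = x ∷ xs} (x∉ ∷ uxs) uys xs⊆ys ys⊆xs with ∈ₚ.∈-∃++ (xs⊆ys (here refl))
... | L , R , refl = ↭-trans (prep x (Unique-ext-↭ uxs uLR there⊆ ⊆there)) (↭-sym ys↭)
  where
    ys↭ = ↭ₚ.shift x L R
    uxLR = Unique-↭ ys↭ uys
    uLR = Unique-tail uxLR
    there⊆ : xs ⊆ L ++ R
    there⊆ m = ∈-tail-≢ (↭ₚ.∈-resp-↭ ys↭ (xs⊆ys (there m))) (λ { refl → Unique-head (x∉ ∷ uxs) m })
    ⊆there : L ++ R ⊆ xs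
    ⊆there m = ∈-tail-≢ (ys⊆xs (↭ₚ.∈-resp-↭ (↭-sym ys↭) (there m))) (λ { refl → Unique-head uxLR m })

InjectiveOn : (A → B) → List A → Set _
InjectiveOn f xs = ∀ x y → x ∈ xs → y ∈ xs → f x ≡ f y → x ≡ y

Unique-map⁺-local : (f : A → B) → ∀ {xs} → Unique xs → InjectiveOn f xs → Unique (map f xs)
Unique-map⁺-local f {[]} u h = []
Unique-map⁺-local f {x ∷ xs} (x∉ ∷ u) h =
  All.tabulate (λ m e → let (y , my , ey) = ∈ₚ.∈-map⁻ f m
                        in All.lookup x∉ my (h x y (here refl) (there my) (trans e ey)))
  ∷ Unique-map⁺-local f u (λ x y mx my → h x y (there mx) (there my))

Unique-map⁻-local : (f : A → B) → ∀ {xs} → Unique (map f xs) → InjectiveOn f xs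
Unique-map⁻-local f {z ∷ xs} (a ∷ u) x y (here refl) (here refl) e = refl
Unique-map⁻-local f {z ∷ xs} (a ∷ u) x y (here refl) (there my) e = ⊥-elim (All.lookup a (∈ₚ.∈-map⁺ f my) e)
Unique-map⁻-local f {z ∷ xs} (a ∷ u) x y (there mx) (here refl) e = ⊥-elim (All.lookup a (∈ₚ.∈-map⁺ f mx) (sym e))
Unique-map⁻-local f {z ∷ xs} (a ∷ u) x y (there mx) (there my) e = Unique-map⁻-local f u x y mx my e

∈-concatMap⁻ : (f : A → List B) → ∀ xs {z} → z ∈ concatMap f xs → ∃ λ x → x ∈ xs × z ∈ f x
∈-concatMap⁻ f xs m = let (ys , mz , my) = ∈ₚ.∈-concat⁻′ (map f xs) m
                          (x , mx , e) = ∈ₚ.∈-map⁻ f my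
                      in x , mx , subst (_ ∈_) e mz

∈-concatMap⁺ : (f : A → List B) → ∀ {xs x z} → x ∈ xs → z ∈ f x → z ∈ concatMap f xs
∈-concatMap⁺ f mx mz = ∈ₚ.∈-concat⁺′ mz (∈ₚ.∈-map⁺ f mx)

Unique-concatMap⁺ : (g : A → List B) → ∀ {xs} → Unique xs → (∀ x → x ∈ xs → Unique (g x)) →
  (∀ x y z → x ∈ xs → y ∈ xs → x ≢ y → z ∈ g x → z ∈ g y → ⊥) → Unique (concatMap g xs)
Unique-concatMap⁺ g {[]} u h d = []
Unique-concatMap⁺ g {x ∷ xs} (x∉ ∷ u) h d =
  Uniqueₚ.++⁺ (h x (here refl)) (Unique-concatMap⁺ g u (λ y m → h y (there m)) (λ x y z mx my → d x y z (there mx) (there my)))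
    (λ (m1 , m2) → let (y , my , mz) = ∈-concatMap⁻ g xs m2
                   in d x y _ (here refl) (there my) (All.lookup x∉ my) m1 mz)

Unique-⊆⇒length≤ : ∀ {xs ys : List A} → Unique xs → xs ⊆ ys → length xs ≤ length ys
Unique-⊆⇒length≤ {xs = []} u h = z≤n
Unique-⊆⇒length≤ {xs = x ∷ xs} {ys} (x∉ ∷ u) h with ∈ₚ.∈-∃++ (h (here refl))
... | L , R , refl = subst (suc (length xs) ≤_) (sym (↭ₚ.↭-length ys↭)) (s≤s (Unique-⊆⇒length≤ u xs⊆LR))
  where
    ys↭ = ↭ₚ.shift x L R
    xs⊆LR : xs ⊆ L ++ R
    xs⊆LR m = ∈-tail-≢ (↭ₚ.∈-resp-↭ ys↭ (h (there m))) (λ { refl → All.lookup x∉ m refl })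

self-injection-↭ : DecidableEquality A → (f : A → A) → ∀ {ys} → Unique ys → (∀ y → y ∈ ys → f y ∈ ys) →
                   InjectiveOn f ys → map f ys ↭ ys
self-injection-↭ _≟_ f {ys} u into inj = Unique-ext-↭ u-fys u fys⊆ys ys⊆fys
  where
    u-fys = Unique-map⁺-local f u inj
    fys⊆ys : map f ys ⊆ ys
    fys⊆ys m = let (y , my , e) = ∈ₚ.∈-map⁻ f m in subst (_∈ ys) (sym e) (into y my)
    ys⊆fys : ys ⊆ map f ys
    ys⊆fys {z} m with any? (z ≟_) (map f ys)
    ... | yes p = p
    ... | no z∉ = ⊥-elim (ℕₚ.<-irrefl refl (subst (λ k → suc k ≤ length ys) (Listₚ.length-map f ys)
                     (Unique-⊆⇒length≤ (All.tabulate (λ mw e → z∉ (subst (_∈ map f ys) (sym e) mw)) ∷ u-fys)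
                                       λ { (here refl) → m ; (there mw) → fys⊆ys mw })))

Unique-++-disjoint : ∀ {xs ys : List A} {z} → Unique (xs ++ ys) → z ∈ xs → z ∈ ys → ⊥
Unique-++-disjoint {xs = x ∷ xs} (x∉ ∷ u) (here refl) m2 = All.lookup x∉ (∈ₚ.∈-++⁺ʳ xs m2) refl
Unique-++-disjoint {xs = x ∷ xs} (x∉ ∷ u) (there m1) m2 = Unique-++-disjoint u m1 m2

Unique-++ʳ : ∀ {xs ys : List A} → Unique (xs ++ ys) → Unique ys
Unique-++ʳ {xs = []} u = u
Unique-++ʳ {xs = x ∷ xs} (_ ∷ u) = Unique-++ʳ {xs = xs} u

Unique-++ˡ : ∀ {xs ys : List A} → Unique (xs ++ ys) → Unique xs
Unique-++ˡ {xs = []} u = []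
Unique-++ˡ {xs = x ∷ xs} (x∉ ∷ u) = All.tabulate (λ m → All.lookup x∉ (∈ₚ.∈-++⁺ˡ m)) ∷ Unique-++ˡ {xs = xs} u

Block : List ℕ → Set
Block S = ¬ (S ≡ []) × Increasing S

-- Blocks are stored increasing, so that a set composition of U has exactly one list representation.
IsSetComposition : List ℕ → List (List ℕ) → Set
IsSetComposition U u = All Block u × (concat u ↭ U)

blocks-Increasing : ∀ {U u} → IsSetComposition U u → All Increasing u
blocks-Increasing (bl , _) = All.map proj₂ bl

block⊆ : ∀ {U u S} → IsSetComposition U u → S ∈ u → S ⊆ U
block⊆ (_ , p) mS mz = ↭ₚ.∈-resp-↭ p (∈ₚ.∈-concat⁺′ mz mS)

splitStep : ℕ → List ℕ × List ℕ → List (List ℕ × List ℕ)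
splitStep x (a , b) = (x ∷ a , b) ∷ (a , x ∷ b) ∷ []

splits-↭ : ∀ xs {a b} → (a , b) ∈ splits xs → a ++ b ↭ xs
splits-↭ [] (here refl) = ↭-refl
splits-↭ (x ∷ xs) m with ∈-concatMap⁻ (splitStep x) (splits xs) m
... | (a , b) , m′ , here refl = prep x (splits-↭ xs m′)
... | (a , b) , m′ , there (here refl) = ↭-trans (↭ₚ.shift x a b) (prep x (splits-↭ xs m′))

splits-Increasing : ∀ xs {a b} → Increasing xs → (a , b) ∈ splits xs → Increasing a × Increasing b
splits-Increasing [] _ (here refl) = [] , []
splits-Increasing (x ∷ xs) (x< ∷ s) m with ∈-concatMap⁻ (splitStep x) (splits xs) m
... | (a , b) , m′ , here refl =
  let (sa , sb) = splits-Increasing xs s m′ in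
  All.tabulate (λ mz → All.lookup x< (↭ₚ.∈-resp-↭ (splits-↭ xs m′) (∈ₚ.∈-++⁺ˡ mz))) ∷ sa , sb
... | (a , b) , m′ , there (here refl) =
  let (sa , sb) = splits-Increasing xs s m′ in
  sa , All.tabulate (λ mz → All.lookup x< (↭ₚ.∈-resp-↭ (splits-↭ xs m′) (∈ₚ.∈-++⁺ʳ a mz))) ∷ sb

partition∈splits : (p : ℕ → Bool) → ∀ xs → (filterᵇ p xs , filterᵇ (λ y → not (p y)) xs) ∈ splits xs
partition∈splits p [] = here refl
partition∈splits p (x ∷ xs) with p x
... | true = ∈-concatMap⁺ (splitStep x) (partition∈splits p xs) (here refl)
... | false = ∈-concatMap⁺ (splitStep x) (partition∈splits p xs) (there (here refl))

∷≢self : ∀ (x : A) xs → x ∷ xs ≢ xs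
∷≢self x xs e = ℕₚ.<-irrefl refl (subst (λ l → length xs < length l) e (ℕₚ.n<1+n (length xs)))

splits-Unique : ∀ xs → Unique xs → Unique (splits xs)
splits-Unique [] _ = [] ∷ []
splits-Unique (x ∷ xs) (x∉ ∷ u) =
  Unique-concatMap⁺ (splitStep x) (splits-Unique xs u)
    (λ { (a , b) _ → ((λ e → ∷≢self x a (cong proj₁ e)) ∷ []) ∷ [] ∷ [] })
    disjoint
  where
    x∉b : ∀ {a b} → (a , b) ∈ splits xs → x ∉ b
    x∉b {a} m mb = All.lookup x∉ (↭ₚ.∈-resp-↭ (splits-↭ xs m) (∈ₚ.∈-++⁺ʳ a mb)) refl
    disjoint : ∀ p q z → p ∈ splits xs → q ∈ splits xs → p ≢ q → z ∈ splitStep x p → z ∈ splitStep x q → ⊥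
    disjoint _ _ _ _ _ p≢q (here refl) (here e) = p≢q (cong₂ _,_ (Listₚ.∷-injectiveʳ (cong proj₁ e)) (cong proj₂ e))
    disjoint _ _ _ mp _ _ (here refl) (there (here e)) = x∉b mp (subst (x ∈_) (sym (cong proj₂ e)) (here refl))
    disjoint _ _ _ _ mq _ (there (here refl)) (here e) = x∉b mq (subst (x ∈_) (cong proj₂ e) (here refl))
    disjoint _ _ _ _ _ p≢q (there (here refl)) (there (here e)) = p≢q (cong₂ _,_ (cong proj₁ e) (Listₚ.∷-injectiveʳ (cong proj₂ e)))

splits-functional : ∀ U {a b d} → Increasing U → (a , b) ∈ splits U → (a , d) ∈ splits U → b ≡ d
splits-functional U {a} s m1 m2 =
  Increasing-ext (proj₂ (splits-Increasing U s m1)) (proj₂ (splits-Increasing U s m2)) (rest⊆ m1 m2) (rest⊆ m2 m1)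
  where
    rest⊆ : ∀ {b d} → (a , b) ∈ splits U → (a , d) ∈ splits U → b ⊆ d
    rest⊆ m1 m2 mz with ∈ₚ.∈-++⁻ a (↭ₚ.∈-resp-↭ (↭-sym (splits-↭ U m2)) (↭ₚ.∈-resp-↭ (splits-↭ U m1) (∈ₚ.∈-++⁺ʳ a mz)))
    ... | inj₁ ma = ⊥-elim (Unique-++-disjoint (Unique-↭ (↭-sym (splits-↭ U m1)) (Increasing⇒Unique s)) ma mz)
    ... | inj₂ md = md

setCompStep : ℕ → List ℕ × List ℕ → List (List (List ℕ))
setCompStep k (a , b) = if null a then [] else map (a ∷_) (setCompsF k b)

setCompsF-sound : ∀ k U {u} → Increasing U → u ∈ setCompsF k U → IsSetComposition U u
setCompsF-sound k [] _ (here refl) = [] , ↭-refl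
setCompsF-sound (suc k) (x ∷ xs) s m with ∈-concatMap⁻ (setCompStep k) (splits (x ∷ xs)) m
... | (y ∷ a , b) , mab , mu with ∈ₚ.∈-map⁻ ((y ∷ a) ∷_) mu
...   | u , mu′ , refl =
  let (sa , sb) = splits-Increasing _ s mab
      (bl , p) = setCompsF-sound k b sb mu′
  in ((λ ()) , sa) ∷ bl , ↭-trans (↭ₚ.++⁺ˡ (y ∷ a) p) (splits-↭ _ mab)

complement : List ℕ → List ℕ → List ℕ
complement S U = filterᵇ (λ y → not (memB y S)) U

module FirstBlock {S rest U : List ℕ} (uU : Unique U) (p : S ++ rest ↭ U) where

  private
    uSrest : Unique (S ++ rest)
    uSrest = Unique-↭ (↭-sym p) uU

  first-block∈splits : Increasing U → Increasing S → (S , complement S U) ∈ splits U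
  first-block∈splits sU sS = subst (λ S′ → (S′ , complement S U) ∈ splits U) filter≡S (partition∈splits (λ y → memB y S) U)
    where
      filter≡S : filterᵇ (λ y → memB y S) U ≡ S
      filter≡S = Increasing-ext (AllPairs-filterᵇ _ sU) sS
        (λ m → memB⇒∈ S (proj₂ (∈-filterᵇ⁻ _ U m)))
        (λ m → ∈-filterᵇ⁺ _ (↭ₚ.∈-resp-↭ p (∈ₚ.∈-++⁺ˡ m)) (∈⇒memB m))

  rest↭complement : rest ↭ complement S U
  rest↭complement = Unique-ext-↭ (Unique-++ʳ {xs = S} uSrest) (AllPairs-filterᵇ _ uU) rest⊆ complement⊆
    where
      rest⊆ : rest ⊆ complement S U
      rest⊆ m = ∈-filterᵇ⁺ _ (↭ₚ.∈-resp-↭ p (∈ₚ.∈-++⁺ʳ S m))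
                  (cong not (∉⇒memB-false (λ mS → Unique-++-disjoint uSrest mS m)))
      complement⊆ : complement S U ⊆ rest
      complement⊆ m with ∈-filterᵇ⁻ _ U m
      ... | mU , e with ∈ₚ.∈-++⁻ S (↭ₚ.∈-resp-↭ (↭-sym p) mU)
      ...   | inj₁ mS = ⊥-elim (memB-false⇒∉ (trans (sym (not-involutive _)) (cong not e)) mS)
      ...   | inj₂ mrest = mrest

  length-complement< : ∀ {x} → x ∈ S → length (complement S U) < length U
  length-complement< mx = length-filterᵇ< _ U (↭ₚ.∈-resp-↭ p (∈ₚ.∈-++⁺ˡ mx)) (cong not (∈⇒memB mx))

setCompsF-complete : ∀ k U {u} → Increasing U → length U ≤ k → IsSetComposition U u → u ∈ setCompsF k U
setCompsF-complete k U {[]} _ _ (_ , p) with refl ← ↭ₚ.↭-empty-inv (↭-sym p) = here refl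
setCompsF-complete k [] {S ∷ u} _ _ ((S≢[] , _) ∷ _ , p) = ⊥-elim (S≢[] (Listₚ.++-conicalˡ S (concat u) (↭ₚ.↭-empty-inv p)))
setCompsF-complete (suc k) (x ∷ xs) {[] ∷ u} _ _ ((S≢[] , _) ∷ _ , _) = ⊥-elim (S≢[] refl)
setCompsF-complete (suc k) (x ∷ xs) {(y ∷ S) ∷ u} sU (s≤s l) ((_ , sS) ∷ bl , p) =
  ∈-concatMap⁺ (setCompStep k) (first-block∈splits sU sS) (∈ₚ.∈-map⁺ ((y ∷ S) ∷_)
    (setCompsF-complete k (complement (y ∷ S) (x ∷ xs)) (AllPairs-filterᵇ (λ z → not (memB z (y ∷ S))) sU)
      (ℕₚ.≤-trans (ℕₚ.≤-pred (length-complement< (here refl))) l)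
      (bl , rest↭complement)))
  where open FirstBlock {y ∷ S} {concat u} (Increasing⇒Unique sU) p

setCompsF-Unique : ∀ k U → Increasing U → Unique (setCompsF k U)
setCompsF-Unique k [] _ = [] ∷ []
setCompsF-Unique zero (x ∷ xs) _ = []
setCompsF-Unique (suc k) (x ∷ xs) s = Unique-concatMap⁺ (setCompStep k) (splits-Unique _ (Increasing⇒Unique s)) unique disjoint
  where
    unique : ∀ p → p ∈ splits (x ∷ xs) → Unique (setCompStep k p)
    unique ([] , b) _ = []
    unique (y ∷ a , b) m = Unique-map⁺-local ((y ∷ a) ∷_) (setCompsF-Unique k b (proj₂ (splits-Increasing _ s m)))
                                             (λ _ _ _ _ → Listₚ.∷-injectiveʳ)
    disjoint : ∀ p q z → p ∈ splits (x ∷ xs) → q ∈ splits (x ∷ xs) → p ≢ q → z ∈ setCompStep k p → z ∈ setCompStep k q → ⊥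
    disjoint (y ∷ a , b) (y′ ∷ c , d) z mp mq p≢q mz1 mz2 with ∈ₚ.∈-map⁻ ((y ∷ a) ∷_) mz1 | ∈ₚ.∈-map⁻ ((y′ ∷ c) ∷_) mz2
    ... | _ , _ , refl | _ , _ , e with refl ← Listₚ.∷-injectiveˡ e = p≢q (cong (y ∷ a ,_) (splits-functional _ s mp mq))

setComps-sound : ∀ U {u} → Increasing U → u ∈ setComps U → IsSetComposition U u
setComps-sound U = setCompsF-sound (length U) U

setComps-complete : ∀ U {u} → Increasing U → IsSetComposition U u → u ∈ setComps U
setComps-complete U s = setCompsF-complete (length U) U s ℕₚ.≤-refl

setComps-Unique : ∀ U → Increasing U → Unique (setComps U)
setComps-Unique U = setCompsF-Unique (length U) U

insertAll-↭ : ∀ x ys {z} → z ∈ insertAll x ys → z ↭ x ∷ ys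
insertAll-↭ x [] (here refl) = ↭-refl
insertAll-↭ x (y ∷ ys) (here refl) = ↭-refl
insertAll-↭ x (y ∷ ys) (there m) with ∈ₚ.∈-map⁻ (y ∷_) m
... | _ , m′ , refl = ↭-trans (prep y (insertAll-↭ x ys m′)) (↭-swap y x ↭-refl)

∈-insertAll : ∀ x L R → L ++ x ∷ R ∈ insertAll x (L ++ R)
∈-insertAll x [] [] = here refl
∈-insertAll x [] (y ∷ R) = here refl
∈-insertAll x (y ∷ L) R = there (∈ₚ.∈-map⁺ (y ∷_) (∈-insertAll x L R))

perms-sound : ∀ xs {σ} → σ ∈ perms xs → σ ↭ xs
perms-sound [] (here refl) = ↭-refl
perms-sound (x ∷ xs) m with ∈-concatMap⁻ (insertAll x) (perms xs) m
... | p , mp , mz = ↭-trans (insertAll-↭ x p mz) (prep x (perms-sound xs mp))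

perms-complete : ∀ xs {σ} → σ ↭ xs → σ ∈ perms xs
perms-complete [] p with refl ← ↭ₚ.↭-empty-inv p = here refl
perms-complete (x ∷ xs) p with ∈ₚ.∈-∃++ (↭ₚ.∈-resp-↭ (↭-sym p) (here refl))
... | L , R , refl =
  ∈-concatMap⁺ (insertAll x) (perms-complete xs (↭ₚ.drop-∷ (↭-trans (↭-sym (↭ₚ.shift x L R)) p))) (∈-insertAll x L R)

removeFirst : ℕ → List ℕ → List ℕ
removeFirst x [] = []
removeFirst x (y ∷ ys) = if x ≡ᵇ y then ys else y ∷ removeFirst x ys

removeFirst-insertAll : ∀ x p {z} → z ∈ insertAll x p → x ∉ p → removeFirst x z ≡ p
removeFirst-insertAll x [] (here refl) _ rewrite ≡ᵇ-refl x = refl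
removeFirst-insertAll x (y ∷ ys) (here refl) _ rewrite ≡ᵇ-refl x = refl
removeFirst-insertAll x (y ∷ ys) (there m) x∉ with ∈ₚ.∈-map⁻ (y ∷_) m
... | _ , m′ , refl rewrite ≢⇒≡ᵇ-false x y (λ e → x∉ (here e)) =
  cong (y ∷_) (removeFirst-insertAll x ys m′ (λ mm → x∉ (there mm)))

insertAll-Unique : ∀ x p → x ∉ p → Unique (insertAll x p)
insertAll-Unique x [] _ = [] ∷ []
insertAll-Unique x (y ∷ ys) x∉ =
  All.tabulate (λ m e → let (_ , _ , e′) = ∈ₚ.∈-map⁻ (y ∷_) m in x∉ (here (Listₚ.∷-injectiveˡ (trans e e′))))
  ∷ Unique-map⁺-local (y ∷_) (insertAll-Unique x ys (λ mm → x∉ (there mm))) (λ _ _ _ _ → Listₚ.∷-injectiveʳ)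

perms-Unique : ∀ xs → Unique xs → Unique (perms xs)
perms-Unique [] _ = [] ∷ []
perms-Unique (x ∷ xs) (x∉xs ∷ u) =
  Unique-concatMap⁺ (insertAll x) (perms-Unique xs u) (λ p m → insertAll-Unique x p (x∉ m))
    (λ p q _ mp mq p≢q m1 m2 → p≢q (trans (sym (removeFirst-insertAll x p m1 (x∉ mp))) (removeFirst-insertAll x q m2 (x∉ mq))))
  where
    x∉ : ∀ {p} → p ∈ perms xs → x ∉ p
    x∉ m mx = All.lookup x∉xs (↭ₚ.∈-resp-↭ (perms-sound xs m) mx) refl

oneTo : ℕ → List ℕ
oneTo n = map suc (upTo n)

oneTo≡applyUpTo : ∀ n → oneTo n ≡ applyUpTo suc n
oneTo≡applyUpTo = Listₚ.map-upTo suc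

oneTo-Increasing : ∀ n → Increasing (oneTo n)
oneTo-Increasing n = subst Increasing (sym (oneTo≡applyUpTo n)) (AllPairsₚ.applyUpTo⁺₁ suc n (λ i<j _ → s≤s i<j))

oneTo-Unique : ∀ n → Unique (oneTo n)
oneTo-Unique n = Increasing⇒Unique (oneTo-Increasing n)

∈-oneTo⁻ : ∀ {n x} → x ∈ oneTo n → 1 ≤ x × x ≤ n
∈-oneTo⁻ m with ∈ₚ.∈-map⁻ suc m
... | _ , mi , refl = s≤s z≤n , ∈ₚ.∈-upTo⁻ mi

∈-oneTo⁺ : ∀ {n x} → 1 ≤ x → x ≤ n → x ∈ oneTo n
∈-oneTo⁺ {x = suc x} (s≤s _) x≤n = ∈ₚ.∈-map⁺ suc (∈ₚ.∈-upTo⁺ x≤n)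

length-oneTo : ∀ n → length (oneTo n) ≡ n
length-oneTo n = trans (Listₚ.length-map suc (upTo n)) (Listₚ.length-upTo n)

oneTo-positive : ∀ n → All (1 ≤_) (oneTo n)
oneTo-positive n = All.tabulate (λ m → proj₁ (∈-oneTo⁻ m))

map-at1-oneTo : ∀ τ → map (at1 τ) (oneTo (length τ)) ≡ τ
map-at1-oneTo τ = trans (cong (map (at1 τ)) (oneTo≡applyUpTo (length τ)))
                        (trans (Listₚ.map-applyUpTo suc (at1 τ) (length τ)) (applyUpTo-at1 τ))
  where
    applyUpTo-at1 : ∀ τ → applyUpTo (λ i → at1 τ (suc i)) (length τ) ≡ τ
    applyUpTo-at1 [] = refl
    applyUpTo-at1 (x ∷ τ) = cong (x ∷_) (applyUpTo-at1 τ)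

insertℕ-↭ : ∀ x ys → insertℕ x ys ↭ x ∷ ys
insertℕ-↭ x [] = ↭-refl
insertℕ-↭ x (y ∷ ys) with x ℕ.≤ᵇ y
... | true = ↭-refl
... | false = ↭-trans (prep y (insertℕ-↭ x ys)) (↭-swap y x ↭-refl)

isort-↭ : ∀ xs → isort xs ↭ xs
isort-↭ [] = ↭-refl
isort-↭ (x ∷ xs) = ↭-trans (insertℕ-↭ x (isort xs)) (prep x (isort-↭ xs))

insertℕ-Increasing : ∀ x ys → Increasing ys → x ∉ ys → Increasing (insertℕ x ys)
insertℕ-Increasing x [] _ _ = [] ∷ []
insertℕ-Increasing x (y ∷ ys) (y< ∷ s) x∉ with x ℕ.≤ᵇ y in eq
... | true = (x<y ∷ All.map (ℕₚ.<-trans x<y) y<) ∷ y< ∷ s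
  where x<y = ℕₚ.≤∧≢⇒< (ℕₚ.≤ᵇ⇒≤ x y (subst T (sym eq) _)) (λ e → x∉ (here e))
... | false = All.tabulate (λ m → [ (λ { (here refl) → y<x }) , All.lookup y< ]′
                                    (∈ₚ.∈-++⁻ [ x ] (↭ₚ.∈-resp-↭ (insertℕ-↭ x ys) m)))
              ∷ insertℕ-Increasing x ys s (λ m → x∉ (there m))
  where y<x = ℕₚ.≰⇒> (λ x≤y → subst T eq (ℕₚ.≤⇒≤ᵇ x≤y))

isort-Increasing : ∀ xs → Unique xs → Increasing (isort xs)
isort-Increasing [] _ = []
isort-Increasing (x ∷ xs) (x∉ ∷ u) =
  insertℕ-Increasing x (isort xs) (isort-Increasing xs u) (λ m → All.lookup x∉ (↭ₚ.∈-resp-↭ (isort-↭ xs) m) refl)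

isort-oneTo : ∀ n {w} → concat w ↭ oneTo n → isort (concat w) ≡ oneTo n
isort-oneTo n p =
  Increasing-ext (isort-Increasing _ (Unique-↭ (↭-sym p) (oneTo-Unique n))) (oneTo-Increasing n)
    (λ m → ↭ₚ.∈-resp-↭ p (↭ₚ.∈-resp-↭ (isort-↭ _) m))
    (λ m → ↭ₚ.∈-resp-↭ (↭-sym (isort-↭ _)) (↭ₚ.∈-resp-↭ (↭-sym p) m))

Valid⇒IsSetComposition : ∀ {w} → ValidSC w → IsSetComposition (isort (concat w)) w
Valid⇒IsSetComposition (bl , _) =
  All.map (λ (S≢[] , (l , _)) → S≢[] , Linkedₚ.Linked⇒AllPairs ℕₚ.<-trans l) bl , ↭-sym (isort-↭ _)

Valid⇒isort-Increasing : ∀ {w} → ValidSC w → Increasing (isort (concat w))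
Valid⇒isort-Increasing {w} (_ , u) = isort-Increasing (concat w) u

IsSetComposition⇒Valid : ∀ {U u} → Increasing U → All (1 ≤_) U → IsSetComposition U u → ValidSC u
IsSetComposition⇒Valid s pos p@(bl , u↭U) =
  All.tabulate (λ mS → let (S≢[] , sS) = All.lookup bl mS in
                       S≢[] , Linkedₚ.AllPairs⇒Linked sS , All.tabulate (λ mz → All.lookup pos (block⊆ p mS mz)))
  , Unique-↭ (↭-sym u↭U) (Increasing⇒Unique s)

SetComps : ℕ → List (List (List ℕ))
SetComps n = setComps (oneTo n)

∈-SetComps⁻ : ∀ {n u} → u ∈ SetComps n → IsSetComposition (oneTo n) u
∈-SetComps⁻ {n} = setComps-sound (oneTo n) (oneTo-Increasing n)

∈-SetComps⁺ : ∀ {n u} → IsSetComposition (oneTo n) u → u ∈ SetComps n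
∈-SetComps⁺ {n} = setComps-complete (oneTo n) (oneTo-Increasing n)

SetComps-Unique : ∀ n → Unique (SetComps n)
SetComps-Unique n = setComps-Unique (oneTo n) (oneTo-Increasing n)

∈-SetComps⇒Valid : ∀ {n u} → u ∈ SetComps n → ValidSC u
∈-SetComps⇒Valid {n} m = IsSetComposition⇒Valid (oneTo-Increasing n) (oneTo-positive n) (∈-SetComps⁻ {n} m)

∈-allPerms⁻ : ∀ {n σ} → σ ∈ allPerms n → σ ↭ oneTo n
∈-allPerms⁻ {n} = perms-sound (oneTo n)

∈-allPerms⁺ : ∀ {n σ} → σ ↭ oneTo n → σ ∈ allPerms n
∈-allPerms⁺ {n} = perms-complete (oneTo n)

allPerms-Unique : ∀ n → Unique (allPerms n)
allPerms-Unique n = perms-Unique (oneTo n) (oneTo-Unique n)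

memIn : List ℕ → ℕ → Bool
memIn T x = memB x T

nonNull : List ℕ → Bool
nonNull S = not (null S)

blockIntersections : List (List ℕ) → List (List ℕ) → List (List ℕ)
blockIntersections u v = concatMap (λ S → map (inter S) v) u

∈-blockIntersections⁻ : ∀ u v {X} → X ∈ blockIntersections u v → ∃ λ S → ∃ λ T → S ∈ u × T ∈ v × X ≡ inter S T
∈-blockIntersections⁻ u v m with ∈-concatMap⁻ (λ S → map (inter S) v) u m
... | S , mS , mX with ∈ₚ.∈-map⁻ (inter S) mX
...   | T , mT , e = S , T , mS , mT , e

∈-meet⁻ : ∀ u v {X} → X ∈ meet u v → nonNull X ≡ true × ∃ λ S → ∃ λ T → S ∈ u × T ∈ v × X ≡ inter S T
∈-meet⁻ u v m = let (mX , e) = ∈-filterᵇ⁻ nonNull (blockIntersections u v) m in e , ∈-blockIntersections⁻ u v mX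

inter-comm : ∀ {S T} → Increasing S → Increasing T → inter S T ≡ inter T S
inter-comm {S} {T} sS sT = Increasing-ext (AllPairs-filterᵇ _ sS) (AllPairs-filterᵇ _ sT) (⊆-swap S T) (⊆-swap T S)
  where
    ⊆-swap : ∀ S T → inter S T ⊆ inter T S
    ⊆-swap S T m = let (mS , mT) = ∈-filterᵇ⁻ (memIn T) S m in ∈-filterᵇ⁺ (memIn S) (memB⇒∈ T mT) (∈⇒memB mS)

filter-memIn-⊆ : ∀ {U S} → Increasing U → Increasing S → S ⊆ U → filterᵇ (memIn S) U ≡ S
filter-memIn-⊆ {U} {S} sU sS S⊆U =
  Increasing-ext (AllPairs-filterᵇ _ sU) sS
    (λ m → memB⇒∈ S (proj₂ (∈-filterᵇ⁻ (memIn S) U m)))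
    (λ m → ∈-filterᵇ⁺ (memIn S) (S⊆U m) (∈⇒memB m))

concat-filter-nonNull : ∀ L → concat (filterᵇ nonNull L) ≡ concat L
concat-filter-nonNull [] = refl
concat-filter-nonNull ([] ∷ L) = concat-filter-nonNull L
concat-filter-nonNull ((x ∷ X) ∷ L) = cong ((x ∷ X) ++_) (concat-filter-nonNull L)

concat-concatMap : (f : A → List (List B)) → ∀ xs → concat (concatMap f xs) ≡ concatMap (λ x → concat (f x)) xs
concat-concatMap f [] = refl
concat-concatMap f (x ∷ xs) = trans (sym (Listₚ.concat-++ (f x) (concatMap f xs))) (cong (concat (f x) ++_) (concat-concatMap f xs))

concatMap-cong-local : (f g : A → List B) → ∀ xs → (∀ x → x ∈ xs → f x ≡ g x) → concatMap f xs ≡ concatMap g xs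
concatMap-cong-local f g [] h = refl
concatMap-cong-local f g (x ∷ xs) h = cong₂ _++_ (h x (here refl)) (concatMap-cong-local f g xs (λ y m → h y (there m)))

concatMap-↭-local : (f g : A → List B) → ∀ xs → (∀ x → x ∈ xs → f x ↭ g x) → concatMap f xs ↭ concatMap g xs
concatMap-↭-local f g [] h = ↭-refl
concatMap-↭-local f g (x ∷ xs) h = ↭ₚ.++⁺ (h x (here refl)) (concatMap-↭-local f g xs (λ y m → h y (there m)))

concat-map-inter : ∀ S v → Increasing S → All Increasing v → concat (map (inter S) v) ≡ filterᵇ (memIn S) (concat v)
concat-map-inter S [] sS sv = refl
concat-map-inter S (T ∷ v) sS (sT ∷ sv) =
  trans (cong₂ _++_ (inter-comm sS sT) (concat-map-inter S v sS sv)) (sym (Listₚ.filter-++ _ T (concat v)))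

concat-meet : ∀ u v → All Increasing u → All Increasing v → concat (meet u v) ≡ concatMap (λ S → filterᵇ (memIn S) (concat v)) u
concat-meet u v su sv =
  trans (concat-filter-nonNull (blockIntersections u v))
  (trans (concat-concatMap (λ S → map (inter S) v) u)
         (concatMap-cong-local _ _ u (λ S mS → concat-map-inter S v (All.lookup su mS) sv)))

meet-IsSetComposition : ∀ {U u v} → Increasing U → IsSetComposition U u → IsSetComposition U v → IsSetComposition U (meet u v)
meet-IsSetComposition {U} {u} {v} sU pu pv = blocks , concat↭
  where
    blocks : All Block (meet u v)
    blocks = All.tabulate λ m → let (e , S , T , mS , mT , eX) = ∈-meet⁻ u v m in
      (λ { refl → contradiction e λ () }) ,
      subst Increasing (sym eX) (AllPairs-filterᵇ _ (All.lookup (blocks-Increasing pu) mS))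
    concat↭ : concat (meet u v) ↭ U
    concat↭ = begin
      concat (meet u v)                                 ≡⟨ concat-meet u v (blocks-Increasing pu) (blocks-Increasing pv) ⟩
      concatMap (λ S → filterᵇ (memIn S) (concat v)) u  ↭⟨ concatMap-↭-local _ _ u (λ _ _ → ↭ₚ.filter-↭ _ (proj₂ pv)) ⟩
      concatMap (λ S → filterᵇ (memIn S) U) u           ≡⟨ concatMap-cong-local _ _ u (λ S mS →
                                                             filter-memIn-⊆ sU (All.lookup (blocks-Increasing pu) mS) (block⊆ pu mS)) ⟩
      concatMap (λ S → S) u                             ≡⟨ cong concat (Listₚ.map-id u) ⟩
      concat u                                          ↭⟨ proj₂ pu ⟩
      U                                                 ∎
      where open PermutationReasoning

blockIntersections-map : (ψ : List ℕ → List ℕ) → ∀ u v → (∀ S T → S ∈ u → T ∈ v → inter (ψ S) (ψ T) ≡ ψ (inter S T)) →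
  blockIntersections (map ψ u) (map ψ v) ≡ map ψ (blockIntersections u v)
blockIntersections-map ψ [] v hi = refl
blockIntersections-map ψ (S ∷ u) v hi =
  trans (cong₂ _++_ (row v (λ T mT → hi S T (here refl) mT)) (blockIntersections-map ψ u v (λ S T mS mT → hi S T (there mS) mT)))
        (sym (Listₚ.map-++ ψ (map (inter S) v) (blockIntersections u v)))
  where
    row : ∀ v → (∀ T → T ∈ v → inter (ψ S) (ψ T) ≡ ψ (inter S T)) → map (inter (ψ S)) (map ψ v) ≡ map ψ (map (inter S) v)
    row [] h = refl
    row (T ∷ v) h = cong₂ _∷_ (h T (here refl)) (row v (λ T m → h T (there m)))

null-length : (X Y : List A) → length X ≡ length Y → null X ≡ null Y
null-length [] [] _ = refl
null-length (x ∷ X) (y ∷ Y) _ = refl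

meet-map : (ψ : List ℕ → List ℕ) → ∀ u v → (∀ S T → S ∈ u → T ∈ v → inter (ψ S) (ψ T) ≡ ψ (inter S T)) →
  (∀ S T → S ∈ u → T ∈ v → length (ψ (inter S T)) ≡ length (inter S T)) → meet (map ψ u) (map ψ v) ≡ map ψ (meet u v)
meet-map ψ u v hi hl rewrite blockIntersections-map ψ u v hi =
  trans (filterᵇ-map nonNull ψ (blockIntersections u v))
        (cong (map ψ) (filterᵇ-cong-local _ _ (blockIntersections u v) λ X m →
           let (S , T , mS , mT , e) = ∈-blockIntersections⁻ u v m in
           subst (λ Y → nonNull (ψ Y) ≡ nonNull Y) (sym e) (cong not (null-length _ _ (hl S T mS mT)))))

memB-map : (α : ℕ → ℕ) (D : List ℕ) → InjectiveOn α D →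
  ∀ {x} T → x ∈ D → T ⊆ D → memB (α x) (map α T) ≡ memB x T
memB-map α D inj {x} T mx T⊆D with memB x T in eq
... | true = ∈⇒memB (∈ₚ.∈-map⁺ α (memB⇒∈ T eq))
... | false = ∉⇒memB-false (λ m → let (y , my , e) = ∈ₚ.∈-map⁻ α m in
                 memB-false⇒∉ eq (subst (_∈ T) (sym (inj x y mx (T⊆D my) e)) my))

inter-map : (α : ℕ → ℕ) (D : List ℕ) → InjectiveOn α D →
  ∀ S T → S ⊆ D → T ⊆ D → inter (map α S) (map α T) ≡ map α (inter S T)
inter-map α D inj S T S⊆D T⊆D =
  trans (filterᵇ-map (memIn (map α T)) α S) (cong (map α) (filterᵇ-cong-local _ _ S (λ x m → memB-map α D inj T (S⊆D m) T⊆D)))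

meet-map-map : (α : ℕ → ℕ) (D : List ℕ) → InjectiveOn α D →
  ∀ u v → (∀ S → S ∈ u → S ⊆ D) → (∀ T → T ∈ v → T ⊆ D) →
  meet (map (map α) u) (map (map α) v) ≡ map (map α) (meet u v)
meet-map-map α D inj u v hu hv = meet-map (map α) u v (λ S T mS mT → inter-map α D inj S T (hu S mS) (hv T mT))
  (λ S T _ _ → Listₚ.length-map α (inter S T))

map-injective-local : (f : A → B) (P : A → Set) → (∀ x y → P x → P y → f x ≡ f y → x ≡ y) →
  ∀ xs ys → All P xs → All P ys → map f xs ≡ map f ys → xs ≡ ys
map-injective-local f P inj [] [] _ _ e = refl
map-injective-local f P inj (x ∷ xs) (y ∷ ys) (px ∷ ax) (py ∷ ay) e =
  cong₂ _∷_ (inj x y px py (Listₚ.∷-injectiveˡ e)) (map-injective-local f P inj xs ys ax ay (Listₚ.∷-injectiveʳ e))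

cut : List ℕ → List A → List (List A)
cut [] xs = []
cut (k ∷ K) xs = take k xs ∷ cut K (drop k xs)

take-length-++ : (S r : List A) → take (length S) (S ++ r) ≡ S
take-length-++ [] r = refl
take-length-++ (x ∷ S) r = cong (x ∷_) (take-length-++ S r)

drop-length-++ : (S r : List A) → drop (length S) (S ++ r) ≡ r
drop-length-++ [] r = refl
drop-length-++ (x ∷ S) r = drop-length-++ S r

length≡0⇒≡[] : ∀ {xs : List A} → length xs ≡ 0 → xs ≡ []
length≡0⇒≡[] {xs = []} _ = refl

cut-concat : (u : List (List A)) → cut (map length u) (concat u) ≡ u
cut-concat [] = refl
cut-concat (S ∷ u) = cong₂ _∷_ (take-length-++ S (concat u))
                              (trans (cong (cut (map length u)) (drop-length-++ S (concat u))) (cut-concat u))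

map-cut : (f : A → B) → ∀ K xs → map (map f) (cut K xs) ≡ cut K (map f xs)
map-cut f [] xs = refl
map-cut f (k ∷ K) xs = cong₂ _∷_ (sym (Listₚ.take-map k xs)) (trans (map-cut f K (drop k xs)) (cong (cut K) (sym (Listₚ.drop-map k xs))))

sum-drop : ∀ k K (xs : List A) → sum (k ∷ K) ≡ length xs → sum K ≡ length (drop k xs)
sum-drop k K xs e = trans (sym (ℕₚ.m+n∸m≡n k (sum K))) (trans (cong (ℕ._∸ k) e) (sym (Listₚ.length-drop k xs)))

length-take-sum : ∀ k K (xs : List A) → sum (k ∷ K) ≡ length xs → length (take k xs) ≡ k
length-take-sum k K xs e = trans (Listₚ.length-take k xs) (ℕₚ.m≤n⇒m⊓n≡m (subst (k ≤_) e (ℕₚ.m≤m+n k (sum K))))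

concat-cut : ∀ K (xs : List A) → sum K ≡ length xs → concat (cut K xs) ≡ xs
concat-cut [] [] e = refl
concat-cut (k ∷ K) xs e = trans (cong (take k xs ++_) (concat-cut K (drop k xs) (sum-drop k K xs e))) (Listₚ.take++drop≡id k xs)

blockSizes-cut : ∀ K (xs : List A) → sum K ≡ length xs → map length (cut K xs) ≡ K
blockSizes-cut [] xs e = refl
blockSizes-cut (k ∷ K) xs e = cong₂ _∷_ (length-take-sum k K xs e) (blockSizes-cut K (drop k xs) (sum-drop k K xs e))

module Relabel (n : ℕ) {τ : List ℕ} (τ↭ : τ ↭ oneTo n) where

  at : ℕ → ℕ
  at = at1 τ

  map-at-oneTo : map at (oneTo n) ≡ τ
  map-at-oneTo = subst (λ k → map at (oneTo k) ≡ τ) (trans (↭ₚ.↭-length τ↭) (length-oneTo n)) (map-at1-oneTo τ)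

  at-injective : InjectiveOn at (oneTo n)
  at-injective = Unique-map⁻-local at (subst Unique (sym map-at-oneTo) (Unique-↭ (↭-sym τ↭) (oneTo-Unique n)))

  at-∈ : ∀ {x} → x ∈ oneTo n → at x ∈ oneTo n
  at-∈ m = ↭ₚ.∈-resp-↭ τ↭ (subst (at _ ∈_) map-at-oneTo (∈ₚ.∈-map⁺ at m))

  relabelBlock : List ℕ → List ℕ
  relabelBlock S = filterᵇ (memIn (map at S)) (oneTo n)

  relabel : List (List ℕ) → List (List ℕ)
  relabel = map relabelBlock

  relabelBlock-Increasing : ∀ S → Increasing (relabelBlock S)
  relabelBlock-Increasing S = AllPairs-filterᵇ _ (oneTo-Increasing n)

  ∈-relabelBlock⁻ : ∀ {S y} → y ∈ relabelBlock S → ∃ λ x → x ∈ S × at x ≡ y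
  ∈-relabelBlock⁻ {S} m = let (x , mx , ex) = ∈ₚ.∈-map⁻ at (memB⇒∈ (map at S) (proj₂ (∈-filterᵇ⁻ _ (oneTo n) m)))
                          in x , mx , sym ex

  ∈-relabelBlock⁺ : ∀ {S x} → x ∈ S → x ∈ oneTo n → at x ∈ relabelBlock S
  ∈-relabelBlock⁺ {S} mx mN = ∈-filterᵇ⁺ _ (at-∈ mN) (∈⇒memB {T = map at S} (∈ₚ.∈-map⁺ at mx))

  relabelBlock-↭ : ∀ S → S ⊆ oneTo n → Unique S → relabelBlock S ↭ map at S
  relabelBlock-↭ S S⊆ u = Unique-ext-↭ (Increasing⇒Unique (relabelBlock-Increasing S))
    (Unique-map⁺-local at u (λ x y mx my → at-injective x y (S⊆ mx) (S⊆ my)))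
    (λ m → let (x , mx , e) = ∈-relabelBlock⁻ m in subst (_∈ map at S) e (∈ₚ.∈-map⁺ at mx))
    (λ m → let (x , mx , e) = ∈ₚ.∈-map⁻ at m in subst (_∈ relabelBlock S) (sym e) (∈-relabelBlock⁺ mx (S⊆ mx)))

  length-relabelBlock : ∀ S → S ⊆ oneTo n → Unique S → length (relabelBlock S) ≡ length S
  length-relabelBlock S S⊆ u = trans (↭ₚ.↭-length (relabelBlock-↭ S S⊆ u)) (Listₚ.length-map at S)

  relabelBlock-injective : ∀ S S′ → Increasing S × S ⊆ oneTo n → Increasing S′ × S′ ⊆ oneTo n →
                           relabelBlock S ≡ relabelBlock S′ → S ≡ S′
  relabelBlock-injective S S′ (sS , S⊆) (sS′ , S′⊆) e = Increasing-ext sS sS′ (⊆-of e S⊆ S′⊆) (⊆-of (sym e) S′⊆ S⊆)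
    where
      ⊆-of : ∀ {S S′} → relabelBlock S ≡ relabelBlock S′ → S ⊆ oneTo n → S′ ⊆ oneTo n → S ⊆ S′
      ⊆-of {S} {S′} e S⊆ S′⊆ {z} mz =
        let (x , mx , ex) = ∈-relabelBlock⁻ (subst (at z ∈_) e (∈-relabelBlock⁺ mz (S⊆ mz)))
        in subst (_∈ S′) (at-injective x z (S′⊆ mx) (S⊆ mz) ex) mx

  memB-at : ∀ {S x} → S ⊆ oneTo n → x ∈ oneTo n → memB (at x) (relabelBlock S) ≡ memB x S
  memB-at {S} {x} S⊆ mN with memB x S in eq
  ... | true = ∈⇒memB (∈-relabelBlock⁺ (memB⇒∈ S eq) mN)
  ... | false = ∉⇒memB-false (λ m → let (y , my , e) = ∈-relabelBlock⁻ m in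
                                   memB-false⇒∉ eq (subst (_∈ S) (at-injective y x (S⊆ my) mN e) my))

  relabelBlock-inter : ∀ S T → S ⊆ oneTo n → T ⊆ oneTo n → inter (relabelBlock S) (relabelBlock T) ≡ relabelBlock (inter S T)
  relabelBlock-inter S T S⊆ T⊆ =
    Increasing-ext (AllPairs-filterᵇ _ (relabelBlock-Increasing S)) (relabelBlock-Increasing (inter S T)) ⊆ʳ ⊆ˡ
    where
      ⊆ʳ : inter (relabelBlock S) (relabelBlock T) ⊆ relabelBlock (inter S T)
      ⊆ʳ m =
        let (m1 , e) = ∈-filterᵇ⁻ _ (relabelBlock S) m
            (x , mx , ex) = ∈-relabelBlock⁻ m1
            (x′ , mx′ , ex′) = ∈-relabelBlock⁻ {S = T} (memB⇒∈ (relabelBlock T) e)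
            x′≡x = at-injective x′ x (T⊆ mx′) (S⊆ mx) (trans ex′ (sym ex))
            x∈S∩T = ∈-filterᵇ⁺ (memIn T) mx (∈⇒memB (subst (_∈ T) x′≡x mx′))
        in subst (_∈ relabelBlock (inter S T)) ex (∈-relabelBlock⁺ x∈S∩T (S⊆ mx))
      ⊆ˡ : relabelBlock (inter S T) ⊆ inter (relabelBlock S) (relabelBlock T)
      ⊆ˡ m =
        let (x , mx , ex) = ∈-relabelBlock⁻ m
            (xS , e) = ∈-filterᵇ⁻ (memIn T) S mx
            xT = memB⇒∈ T e
        in subst (_∈ inter (relabelBlock S) (relabelBlock T)) ex
             (∈-filterᵇ⁺ (memIn (relabelBlock T)) (∈-relabelBlock⁺ xS (S⊆ xS)) (∈⇒memB (∈-relabelBlock⁺ xT (T⊆ xT))))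

  module _ {u} (p : IsSetComposition (oneTo n) u) where

    blockSizes-relabel : map length (relabel u) ≡ map length u
    blockSizes-relabel = trans (sym (Listₚ.map-∘ u)) (Listₚ.map-cong-local (All.tabulate λ {S} mS →
      length-relabelBlock S (block⊆ p mS) (Increasing⇒Unique (All.lookup (blocks-Increasing p) mS))))

    relabel-IsSetComposition : IsSetComposition (oneTo n) (relabel u)
    relabel-IsSetComposition = blocks , concat↭
      where
        nonEmpty : ∀ {S} → S ∈ u → ¬ (relabelBlock S ≡ [])
        nonEmpty {[]} mS _ = proj₁ (All.lookup (proj₁ p) mS) refl
        nonEmpty {s ∷ S} mS e with () ← subst (at s ∈_) e (∈-relabelBlock⁺ {S = s ∷ S} (here refl) (block⊆ p mS (here refl)))
        blocks : All Block (relabel u)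
        blocks = All.tabulate λ m → let (S , mS , e) = ∈ₚ.∈-map⁻ relabelBlock m in
          subst Block (sym e) (nonEmpty mS , relabelBlock-Increasing S)
        concat↭ : concat (relabel u) ↭ oneTo n
        concat↭ = begin
          concat (map relabelBlock u)  ↭⟨ concatMap-↭-local relabelBlock (map at) u (λ S mS →
                                            relabelBlock-↭ S (block⊆ p mS) (Increasing⇒Unique (All.lookup (blocks-Increasing p) mS))) ⟩
          concat (map (map at) u)      ≡⟨ Listₚ.concat-map u ⟩
          map at (concat u)            ↭⟨ ↭ₚ.map⁺ at (proj₂ p) ⟩
          map at (oneTo n)             ≡⟨ map-at-oneTo ⟩
          τ                            ↭⟨ τ↭ ⟩
          oneTo n                      ∎
          where open PermutationReasoning

    relabel-cut : concat u ≡ τ → relabel (cut (map length u) (oneTo n)) ≡ u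
    relabel-cut e = begin
      map relabelBlock (cut K (oneTo n))                   ≡⟨ Listₚ.map-∘ (cut K (oneTo n)) ⟩
      map (λ X → filterᵇ (memIn X) (oneTo n)) (map (map at) (cut K (oneTo n)))
        ≡⟨ cong (map (λ X → filterᵇ (memIn X) (oneTo n))) cut≡u ⟩
      map (λ X → filterᵇ (memIn X) (oneTo n)) u
        ≡⟨ Listₚ.map-id-local (All.tabulate λ m → filter-memIn-⊆ (oneTo-Increasing n) (All.lookup (blocks-Increasing p) m) (block⊆ p m)) ⟩
      u                                                    ∎
      where
        open ≡.≡-Reasoning
        K = map length u
        cut≡u : map (map at) (cut K (oneTo n)) ≡ u
        cut≡u = trans (map-cut at K (oneTo n)) (trans (cong (cut K) (trans map-at-oneTo (sym e))) (cut-concat u))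

  relabel-injective : ∀ {u u′} → IsSetComposition (oneTo n) u → IsSetComposition (oneTo n) u′ → relabel u ≡ relabel u′ → u ≡ u′
  relabel-injective p p′ = map-injective-local relabelBlock (λ S → Increasing S × S ⊆ oneTo n) relabelBlock-injective _ _
     (All.tabulate (λ m → All.lookup (blocks-Increasing p) m , block⊆ p m))
     (All.tabulate (λ m → All.lookup (blocks-Increasing p′) m , block⊆ p′ m))

  relabel-meet : ∀ {u v} → IsSetComposition (oneTo n) u → IsSetComposition (oneTo n) v → meet (relabel u) (relabel v) ≡ relabel (meet u v)
  relabel-meet {u} {v} pu pv = meet-map relabelBlock u v
    (λ S T mS mT → relabelBlock-inter S T (block⊆ pu mS) (block⊆ pv mT))
    (λ S T mS mT → length-relabelBlock (inter S T)
        (λ mz → block⊆ pu mS (proj₁ (∈-filterᵇ⁻ (memIn T) S mz)))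
        (AllPairs-filterᵇ _ (Increasing⇒Unique (All.lookup (blocks-Increasing pu) mS))))

  concat-meet-relabel : ∀ {u v} → IsSetComposition (oneTo n) u → IsSetComposition (oneTo n) v → concat v ≡ τ →
                        concat (meet (relabel u) v) ≡ map at (concat u)
  concat-meet-relabel {u} {v} pu pv ev =
    trans (concat-meet (relabel u) v (blocks-Increasing (relabel-IsSetComposition pu)) (blocks-Increasing pv))
          (trans (Listₚ.concatMap-map _ relabelBlock u)
                 (trans (concatMap-cong-local _ _ u (λ S mS → block S (block⊆ pu mS) (All.lookup (blocks-Increasing pu) mS)))
                        (Listₚ.concat-map u)))
    where
      block : ∀ S → S ⊆ oneTo n → Increasing S → filterᵇ (memIn (relabelBlock S)) (concat v) ≡ map at S
      block S S⊆ sS =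
        trans (cong (filterᵇ (memIn (relabelBlock S))) (trans ev (sym map-at-oneTo)))
        (trans (filterᵇ-map (memIn (relabelBlock S)) at (oneTo n))
          (cong (map at) (trans (filterᵇ-cong-local _ _ (oneTo n) (λ x m → memB-at S⊆ m))
                                (filter-memIn-⊆ (oneTo-Increasing n) sS S⊆))))

  map-relabel-↭ : map relabel (SetComps n) ↭ SetComps n
  map-relabel-↭ = self-injection-↭ (Listₚ.≡-dec (Listₚ.≡-dec ℕ._≟_)) relabel (SetComps-Unique n)
    (λ u m → ∈-SetComps⁺ {n} (relabel-IsSetComposition (∈-SetComps⁻ {n} m)))
    (λ u u′ m m′ → relabel-injective (∈-SetComps⁻ {n} m) (∈-SetComps⁻ {n} m′))

-- Positions are 0-based: Adjacent π p x y says that π(p + 1) = x and π(p + 2) = y.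
data Adjacent : List ℕ → ℕ → ℕ → ℕ → Set where
  adj₀ : ∀ {x y r} → Adjacent (x ∷ y ∷ r) 0 x y
  adj₊ : ∀ {z r p x y} → Adjacent r p x y → Adjacent (z ∷ r) (suc p) x y

Adjacent-length : ∀ {π p x y} → Adjacent π p x y → suc (suc p) ≤ length π
Adjacent-length adj₀ = s≤s (s≤s z≤n)
Adjacent-length (adj₊ a) = s≤s (Adjacent-length a)

Adjacent-Unique⇒≢ : ∀ {π p x y} → Unique π → Adjacent π p x y → x ≢ y
Adjacent-Unique⇒≢ (x∉ ∷ _) adj₀ = All.lookup x∉ (here refl)
Adjacent-Unique⇒≢ (_ ∷ u) (adj₊ a) = Adjacent-Unique⇒≢ u a

Increasing⇒Adjacent-< : ∀ {π p x y} → Increasing π → Adjacent π p x y → x < y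
Increasing⇒Adjacent-< ((x<y ∷ _) ∷ _) adj₀ = x<y
Increasing⇒Adjacent-< (_ ∷ s) (adj₊ a) = Increasing⇒Adjacent-< s a

Adjacent-<⇒Increasing : ∀ π → (∀ p x y → Adjacent π p x y → x < y) → Increasing π
Adjacent-<⇒Increasing π h = Linkedₚ.Linked⇒AllPairs ℕₚ.<-trans (linked π h)
  where
    linked : ∀ π → (∀ p x y → Adjacent π p x y → x < y) → Linked _<_ π
    linked [] h = []
    linked (x ∷ []) h = [-]
    linked (x ∷ y ∷ r) h = h 0 x y adj₀ ∷ linked (y ∷ r) (λ p a b ad → h (suc p) a b (adj₊ ad))

Adjacent-++ˡ : ∀ S T {p x y} → Adjacent S p x y → Adjacent (S ++ T) p x y
Adjacent-++ˡ (x ∷ y ∷ r) T adj₀ = adj₀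
Adjacent-++ˡ (z ∷ r) T (adj₊ a) = adj₊ (Adjacent-++ˡ r T a)

Adjacent-++ʳ : ∀ S T {q x y} → Adjacent T q x y → Adjacent (S ++ T) (length S ℕ.+ q) x y
Adjacent-++ʳ [] T a = a
Adjacent-++ʳ (s ∷ S) T a = adj₊ (Adjacent-++ʳ S T a)

Adjacent-++⁻ : ∀ S T {p x y} → Adjacent (S ++ T) p x y →
  Adjacent S p x y ⊎ (suc p ≡ length S × ¬ (T ≡ [])) ⊎ (∃ λ q → Adjacent T q x y × p ≡ length S ℕ.+ q)
Adjacent-++⁻ [] T a = inj₂ (inj₂ (_ , a , refl))
Adjacent-++⁻ (s ∷ []) (t ∷ T) adj₀ = inj₂ (inj₁ (refl , λ ()))
Adjacent-++⁻ (s ∷ []) T (adj₊ a) = inj₂ (inj₂ (_ , a , refl))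
Adjacent-++⁻ (s ∷ s′ ∷ S) T adj₀ = inj₁ adj₀
Adjacent-++⁻ (s ∷ s′ ∷ S) T (adj₊ a) with Adjacent-++⁻ (s′ ∷ S) T a
... | inj₁ a′ = inj₁ (adj₊ a′)
... | inj₂ (inj₁ (e , T≢[])) = inj₂ (inj₁ (cong suc e , T≢[]))
... | inj₂ (inj₂ (q , a′ , e)) = inj₂ (inj₂ (q , a′ , cong suc e))

T⇒≡true : ∀ {b} → T b → b ≡ true
T⇒≡true {true} _ = refl

∈-descentsFrom⁻ : ∀ i π {j} → j ∈ descentsFrom i π → ∃ λ p → ∃ λ x → ∃ λ y → Adjacent π p x y × y < x × j ≡ i ℕ.+ p
∈-descentsFrom⁻ i (x ∷ y ∷ r) m with y ℕ.<ᵇ x in eq | ∈-descentsFrom⁻ (suc i) (y ∷ r)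
∈-descentsFrom⁻ i (x ∷ y ∷ r) (here refl) | true | _ =
  0 , x , y , adj₀ , ℕₚ.<ᵇ⇒< y x (subst T (sym eq) _) , sym (ℕₚ.+-identityʳ i)
∈-descentsFrom⁻ i (x ∷ y ∷ r) (there m) | true | rec =
  let (p , a , b , ad , b<a , e) = rec m in suc p , a , b , adj₊ ad , b<a , trans e (sym (ℕₚ.+-suc i p))
∈-descentsFrom⁻ i (x ∷ y ∷ r) m | false | rec =
  let (p , a , b , ad , b<a , e) = rec m in suc p , a , b , adj₊ ad , b<a , trans e (sym (ℕₚ.+-suc i p))

∈-descentsFrom⁺ : ∀ i π {p x y} → Adjacent π p x y → y < x → (i ℕ.+ p) ∈ descentsFrom i π
∈-descentsFrom⁺ i (x ∷ y ∷ r) adj₀ y<x rewrite T⇒≡true (ℕₚ.<⇒<ᵇ y<x) | ℕₚ.+-identityʳ i = here refl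
∈-descentsFrom⁺ i (z ∷ y ∷ r) {suc p} (adj₊ a) y<x with y ℕ.<ᵇ z
... | true = there (subst (_∈ descentsFrom (suc i) (y ∷ r)) (sym (ℕₚ.+-suc i p)) (∈-descentsFrom⁺ (suc i) (y ∷ r) a y<x))
... | false = subst (_∈ descentsFrom (suc i) (y ∷ r)) (sym (ℕₚ.+-suc i p)) (∈-descentsFrom⁺ (suc i) (y ∷ r) a y<x)

partialSumsFrom-≥ : ∀ acc k K {j} → j ∈ partialSumsFrom acc (k ∷ K) → All (1 ≤_) K → acc ℕ.+ k ≤ j
partialSumsFrom-≥ acc k (k′ ∷ K) (here refl) _ = ℕₚ.≤-refl
partialSumsFrom-≥ acc k (k′ ∷ K) (there m) (_ ∷ ps) =
  ℕₚ.≤-trans (ℕₚ.m≤m+n (acc ℕ.+ k) k′) (partialSumsFrom-≥ (acc ℕ.+ k) k′ K m ps)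

∈-partialSumsFrom-tail : ∀ acc k K {j} → j ∈ partialSumsFrom acc (k ∷ K) → j ≢ acc ℕ.+ k → j ∈ partialSumsFrom (acc ℕ.+ k) K
∈-partialSumsFrom-tail acc k (k′ ∷ K) (here refl) j≢ = ⊥-elim (j≢ refl)
∈-partialSumsFrom-tail acc k (k′ ∷ K) (there m) _ = m

∈-partialSumsFrom-head : ∀ acc k K → ¬ (K ≡ []) → (acc ℕ.+ k) ∈ partialSumsFrom acc (k ∷ K)
∈-partialSumsFrom-head acc k [] K≢[] = ⊥-elim (K≢[] refl)
∈-partialSumsFrom-head acc k (k′ ∷ K) _ = here refl

∈-partialSumsFrom-there : ∀ acc k K {j} → j ∈ partialSumsFrom (acc ℕ.+ k) K → j ∈ partialSumsFrom acc (k ∷ K)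
∈-partialSumsFrom-there acc k (k′ ∷ K) m = there m

+-suc-+ : ∀ a k q → a ℕ.+ suc (k ℕ.+ q) ≡ (a ℕ.+ k) ℕ.+ suc q
+-suc-+ a k q = trans (ℕₚ.+-suc a (k ℕ.+ q)) (trans (cong suc (sym (ℕₚ.+-assoc a k q))) (sym (ℕₚ.+-suc (a ℕ.+ k) q)))

+-suc-+-≢ : ∀ a k q → a ℕ.+ suc (k ℕ.+ q) ≢ a ℕ.+ k
+-suc-+-≢ a k q e = ℕₚ.<-irrefl (sym e) (ℕₚ.+-monoʳ-< a (s≤s (ℕₚ.m≤m+n k q)))

-- acc shifts the cut positions, so that the recursion can walk along K.
AscentsOffCuts : ℕ → List ℕ → List ℕ → Set
AscentsOffCuts acc K π = ∀ p x y → Adjacent π p x y → (acc ℕ.+ suc p) ∉ partialSumsFrom acc K → x < y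

AscentsOffCuts⇒cut-Increasing : ∀ acc K π → All (1 ≤_) K → sum K ≡ length π → AscentsOffCuts acc K π → All Increasing (cut K π)
AscentsOffCuts⇒cut-Increasing acc [] π _ _ _ = []
AscentsOffCuts⇒cut-Increasing acc (k ∷ K) π (_ ∷ ps) e h =
  front-Increasing ∷ AscentsOffCuts⇒cut-Increasing (acc ℕ.+ k) K (drop k π) ps (sum-drop k K π e) rest-ascents
  where
    front = take k π
    rest = drop k π
    split : front ++ rest ≡ π
    split = Listₚ.take++drop≡id k π
    length-front : length front ≡ k
    length-front = length-take-sum k K π e
    front-Increasing : Increasing front
    front-Increasing = Adjacent-<⇒Increasing front λ p x y a →
      h p x y (subst (λ l → Adjacent l p x y) split (Adjacent-++ˡ front rest a))
        (λ m → ℕₚ.<⇒≱ (ℕₚ.+-monoʳ-< acc (subst (suc (suc p) ≤_) length-front (Adjacent-length a)))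
                      (partialSumsFrom-≥ acc k K m ps))
    rest-ascents : AscentsOffCuts (acc ℕ.+ k) K rest
    rest-ascents q x y a q∉ =
      h (k ℕ.+ q) x y (subst (λ l → Adjacent l (k ℕ.+ q) x y) split
                             (subst (λ l → Adjacent (front ++ rest) (l ℕ.+ q) x y) length-front (Adjacent-++ʳ front rest a)))
        (λ m → q∉ (subst (_∈ partialSumsFrom (acc ℕ.+ k) K) (+-suc-+ acc k q)
                         (∈-partialSumsFrom-tail acc k K m (+-suc-+-≢ acc k q))))

cut-Increasing⇒AscentsOffCuts : ∀ acc K π → All (1 ≤_) K → sum K ≡ length π → All Increasing (cut K π) → AscentsOffCuts acc K π
cut-Increasing⇒AscentsOffCuts acc [] [] _ _ _ p x y () _
cut-Increasing⇒AscentsOffCuts acc (k ∷ K) π (_ ∷ ps) e (front-Increasing ∷ rest-Increasing) p x y a p∉ =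
  ascent (Adjacent-++⁻ front rest (subst (λ l → Adjacent l p x y) (sym split) a))
  where
    front = take k π
    rest = drop k π
    split : front ++ rest ≡ π
    split = Listₚ.take++drop≡id k π
    length-front : length front ≡ k
    length-front = length-take-sum k K π e
    ascent : Adjacent front p x y ⊎ (suc p ≡ length front × ¬ (rest ≡ [])) ⊎ (∃ λ q → Adjacent rest q x y × p ≡ length front ℕ.+ q) → x < y
    ascent (inj₁ a′) = Increasing⇒Adjacent-< front-Increasing a′
    ascent (inj₂ (inj₁ (e′ , rest≢[]))) =
      ⊥-elim (p∉ (subst (λ l → (acc ℕ.+ l) ∈ partialSumsFrom acc (k ∷ K)) (sym (trans e′ length-front))
                        (∈-partialSumsFrom-head acc k K K≢[])))
      where
        K≢[] : ¬ (K ≡ [])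
        K≢[] refl = rest≢[] (length≡0⇒≡[] (sym (sum-drop k [] π e)))
    ascent (inj₂ (inj₂ (q , a′ , e′))) =
      cut-Increasing⇒AscentsOffCuts (acc ℕ.+ k) K rest ps (sum-drop k K π e) rest-Increasing q x y a′
        (λ m → p∉ (subst (_∈ partialSumsFrom acc (k ∷ K))
                         (sym (trans (cong (λ l → acc ℕ.+ suc l) (trans e′ (cong (ℕ._+ q) length-front))) (+-suc-+ acc k q)))
                         (∈-partialSumsFrom-there acc k K m)))

descentsWithin : List ℕ → List ℕ → Bool
descentsWithin K π = all (λ i → memB i (partialSums K)) (descents π)

all≡true⁻ : (p : A → Bool) → ∀ xs → all p xs ≡ true → ∀ {x} → x ∈ xs → p x ≡ true
all≡true⁻ p (y ∷ xs) e (here refl) with p y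
... | true = refl
all≡true⁻ p (y ∷ xs) e (there m) with p y
... | true = all≡true⁻ p xs e m

all≡true⁺ : (p : A → Bool) → ∀ xs → (∀ x → x ∈ xs → p x ≡ true) → all p xs ≡ true
all≡true⁺ p [] h = refl
all≡true⁺ p (y ∷ xs) h rewrite h y (here refl) = all≡true⁺ p xs (λ x m → h x (there m))

-- The combinatorial core of φ(1_K) = D_K.
descentsWithin⇒cut-Increasing : ∀ K π → Unique π → All (1 ≤_) K → sum K ≡ length π →
                                descentsWithin K π ≡ true → All Increasing (cut K π)
descentsWithin⇒cut-Increasing K π u ps e ok = AscentsOffCuts⇒cut-Increasing 0 K π ps e ascents
  where
    ascents : AscentsOffCuts 0 K π
    ascents p x y a p∉ with ℕₚ.<-cmp x y
    ... | tri< x<y _ _ = x<y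
    ... | tri≈ _ x≡y _ = ⊥-elim (Adjacent-Unique⇒≢ u a x≡y)
    ... | tri> _ _ y<x = ⊥-elim (p∉ (memB⇒∈ (partialSums K) (all≡true⁻ _ (descents π) ok (∈-descentsFrom⁺ 1 π a y<x))))

cut-Increasing⇒descentsWithin : ∀ K π → All (1 ≤_) K → sum K ≡ length π → All Increasing (cut K π) → descentsWithin K π ≡ true
cut-Increasing⇒descentsWithin K π ps e s = all≡true⁺ _ (descents π) within
  where
    within : ∀ j → j ∈ descents π → memB j (partialSums K) ≡ true
    within j m with ∈-descentsFrom⁻ 1 π m
    ... | p , x , y , a , y<x , refl with memB (suc p) (partialSums K) in eq
    ...   | true = refl
    ...   | false = ⊥-elim (ℕₚ.<-asym y<x (cut-Increasing⇒AscentsOffCuts 0 K π ps e s p x y a (memB-false⇒∉ eq)))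

cut-nonEmpty : ∀ K (xs : List A) → All (1 ≤_) K → sum K ≡ length xs → All (λ S → ¬ (S ≡ [])) (cut K xs)
cut-nonEmpty [] xs _ _ = []
cut-nonEmpty (suc k ∷ K) (x ∷ xs) (_ ∷ ps) e = (λ ()) ∷ cut-nonEmpty K (drop k xs) ps (sum-drop (suc k) K (x ∷ xs) e)

cut-IsSetComposition : ∀ K {U} (xs : List ℕ) → All (1 ≤_) K → sum K ≡ length xs → All Increasing (cut K xs) → xs ↭ U →
                       IsSetComposition U (cut K xs)
cut-IsSetComposition K xs ps e s xs↭U = All.zip (cut-nonEmpty K xs ps e , s) , ↭-trans (↭-reflexive (concat-cut K xs e)) xs↭U

module _ {n K π} (π↭ : π ↭ oneTo n) (K-comp : IsComposition n K) where

  private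
    ps : All (1 ≤_) K
    ps = proj₁ K-comp
    sum≡length : sum K ≡ length π
    sum≡length = trans (proj₂ K-comp) (sym (trans (↭ₚ.↭-length π↭) (length-oneTo n)))

  cut∈SetComps : descentsWithin K π ≡ true → cut K π ∈ SetComps n
  cut∈SetComps ok = ∈-SetComps⁺ {n} (cut-IsSetComposition K π ps sum≡length
    (descentsWithin⇒cut-Increasing K π (Unique-↭ (↭-sym π↭) (oneTo-Unique n)) ps sum≡length ok) π↭)

  cut∈SetComps⇒descentsWithin : cut K π ∈ SetComps n → descentsWithin K π ≡ true
  cut∈SetComps⇒descentsWithin m = cut-Increasing⇒descentsWithin K π ps sum≡length (blocks-Increasing (∈-SetComps⁻ {n} m))

take⊆ : ∀ k (xs : List A) → take k xs ⊆ xs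
take⊆ (suc k) (x ∷ xs) (here refl) = here refl
take⊆ (suc k) (x ∷ xs) (there m) = there (take⊆ k xs m)

drop⊆ : ∀ k (xs : List A) → drop k xs ⊆ xs
drop⊆ zero xs m = m
drop⊆ (suc k) (x ∷ xs) m = there (drop⊆ k xs m)

take-++-≤ : ∀ k (xs ys : List A) → k ≤ length xs → take k (xs ++ ys) ≡ take k xs
take-++-≤ zero xs ys _ = refl
take-++-≤ (suc k) (x ∷ xs) ys (s≤s k≤) = cong (x ∷_) (take-++-≤ k xs ys k≤)

drop-++-≤ : ∀ k (xs ys : List A) → k ≤ length xs → drop k (xs ++ ys) ≡ drop k xs ++ ys
drop-++-≤ zero xs ys _ = refl
drop-++-≤ (suc k) (x ∷ xs) ys (s≤s k≤) = drop-++-≤ k xs ys k≤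

++-≡-++-prefix : ∀ (ys zs xs ws : List A) → length ys ≤ length xs → ys ++ zs ≡ xs ++ ws →
  xs ≡ ys ++ drop (length ys) xs × zs ≡ drop (length ys) xs ++ ws
++-≡-++-prefix ys zs xs ws ys≤ e =
  trans (sym (Listₚ.take++drop≡id (length ys) xs)) (cong (_++ drop (length ys) xs) take≡)
  , trans (sym (drop-length-++ ys zs)) (trans (cong (drop (length ys)) e) (drop-++-≤ (length ys) xs ws ys≤))
  where
    take≡ : take (length ys) xs ≡ ys
    take≡ = trans (sym (take-++-≤ (length ys) xs ws ys≤)) (trans (cong (take (length ys)) (sym e)) (take-length-++ ys zs))

Increasing-++ : ∀ {xs ys} → Increasing (xs ++ ys) → ∀ {a b} → a ∈ xs → b ∈ ys → a < b
Increasing-++ {x ∷ xs} (x< ∷ _) (here refl) mb = All.lookup x< (∈ₚ.∈-++⁺ʳ xs mb)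
Increasing-++ {x ∷ xs} (_ ∷ s) (there ma) mb = Increasing-++ s ma mb

nonEmpty⇒length≥1 : (xs : List A) → ¬ (xs ≡ []) → 1 ≤ length xs
nonEmpty⇒length≥1 [] xs≢[] = ⊥-elim (xs≢[] refl)
nonEmpty⇒length≥1 (x ∷ xs) _ = s≤s z≤n

length≥1⇒nonEmpty : (xs : List A) → 1 ≤ length xs → ¬ (xs ≡ [])
length≥1⇒nonEmpty (x ∷ xs) _ ()

_≻_ : List ℕ → List ℕ → Set
S ≻ T = ∀ {a b} → a ∈ S → b ∈ T → b < a

≻-⊆ : ∀ {S S′ T} → S′ ⊆ S → S ≻ T → S′ ≻ T
≻-⊆ S′⊆S S≻T ma = S≻T (S′⊆S ma)

DecreasingBlocks : List (List ℕ) → Set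
DecreasingBlocks = Linked _≻_

NonEmpty : List ℕ → Set
NonEmpty S = ¬ (S ≡ [])

increasing-cannot-straddle : ∀ {X Y′ x rest} → NonEmpty X → NonEmpty Y′ → All NonEmpty x → Linked _≻_ (X ∷ x) →
                             Increasing (X ++ Y′) → concat x ≡ Y′ ++ rest → ⊥
increasing-cannot-straddle {Y′ = []} _ Y′≢[] _ _ _ _ = Y′≢[] refl
increasing-cannot-straddle {Y′ = c ∷ _} {[]} {rest} _ Y′≢[] _ _ _ e = Y′≢[] (Listₚ.++-conicalˡ _ rest (sym e))
increasing-cannot-straddle {Y′ = c ∷ _} {[] ∷ _} _ _ (X2≢[] ∷ _) _ _ _ = X2≢[] refl
increasing-cannot-straddle {X = []} X≢[] _ _ _ _ _ = X≢[] refl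
increasing-cannot-straddle {X = a ∷ X₀} {c ∷ Y₀} {(d ∷ _) ∷ _} _ _ _ (X≻X2 ∷ _) s e
  with refl ← Listₚ.∷-injectiveˡ e =
  ℕₚ.<-asym (X≻X2 (here refl) (here refl)) (Increasing-++ {a ∷ X₀} {c ∷ Y₀} s (here refl) (here refl))

refines-decreasing : ∀ u x → All Increasing u → All NonEmpty u → All NonEmpty x → DecreasingBlocks x →
                     concat u ≡ concat x → u ≡ x ⊎ length x < length u
refines-decreasing [] [] _ _ _ _ _ = inj₁ refl
refines-decreasing [] (X ∷ x) _ _ (X≢[] ∷ _) _ e = ⊥-elim (X≢[] (Listₚ.++-conicalˡ X (concat x) (sym e)))
refines-decreasing (Y ∷ u) [] _ (Y≢[] ∷ _) _ _ e = ⊥-elim (Y≢[] (Listₚ.++-conicalˡ Y (concat u) e))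
refines-decreasing (Y ∷ u) (X ∷ x) (sY ∷ su) (_ ∷ nu) (X≢[] ∷ nx) dec e with ℕₚ.<-cmp (length Y) (length X)
... | tri≈ _ |Y|≡|X| _ = cons (refines-decreasing u x su nu nx (tail dec) (trans (proj₂ split) (cong (_++ concat x) rest≡[])))
  where
    split = ++-≡-++-prefix Y (concat u) X (concat x) (ℕₚ.≤-reflexive |Y|≡|X|) e
    rest≡[] : drop (length Y) X ≡ []
    rest≡[] = length≡0⇒≡[] (trans (Listₚ.length-drop (length Y) X) (trans (cong (length X ℕ.∸_) |Y|≡|X|) (ℕₚ.n∸n≡0 (length X))))
    cons : u ≡ x ⊎ length x < length u → Y ∷ u ≡ X ∷ x ⊎ suc (length x) < suc (length u)
    cons (inj₁ refl) = inj₁ (cong (_∷ u) (sym (trans (proj₁ split) (trans (cong (Y ++_) rest≡[]) (Listₚ.++-identityʳ Y)))))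
    cons (inj₂ lt) = inj₂ (s≤s lt)
    tail : ∀ {X x} → Linked _≻_ (X ∷ x) → Linked _≻_ x
    tail [-] = []
    tail (_ ∷ l) = l
... | tri< |Y|<|X| _ _ = longer (refines-decreasing u (X′ ∷ x) su nu (X′≢[] ∷ nx) (shrink x dec) (proj₂ split))
  where
    split = ++-≡-++-prefix Y (concat u) X (concat x) (ℕₚ.<⇒≤ |Y|<|X|) e
    X′ = drop (length Y) X
    X′≢[] : NonEmpty X′
    X′≢[] = length≥1⇒nonEmpty X′ (subst (1 ≤_) (sym (Listₚ.length-drop (length Y) X)) (ℕₚ.m<n⇒0<n∸m |Y|<|X|))
    shrink : ∀ x → Linked _≻_ (X ∷ x) → Linked _≻_ (X′ ∷ x)
    shrink [] _ = [-]
    shrink (_ ∷ _) (X≻ ∷ l) = ≻-⊆ (drop⊆ (length Y) X) X≻ ∷ l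
    longer : u ≡ X′ ∷ x ⊎ suc (length x) < length u → Y ∷ u ≡ X ∷ x ⊎ suc (length x) < suc (length u)
    longer (inj₁ refl) = inj₂ (s≤s (ℕₚ.n<1+n _))
    longer (inj₂ lt) = inj₂ (s≤s (ℕₚ.<-trans (ℕₚ.n<1+n _) lt))
... | tri> _ _ |X|<|Y| = ⊥-elim (increasing-cannot-straddle X≢[] Y′≢[] nx dec (subst Increasing (proj₁ split) sY) (proj₂ split))
  where
    split = ++-≡-++-prefix X (concat x) Y (concat u) (ℕₚ.<⇒≤ |X|<|Y|) (sym e)
    Y′≢[] : NonEmpty (drop (length X) Y)
    Y′≢[] = length≥1⇒nonEmpty _ (subst (1 ≤_) (sym (Listₚ.length-drop (length X) Y)) (ℕₚ.m<n⇒0<n∸m |X|<|Y|))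

cutFromRight : List ℕ → List ℕ → List (List ℕ)
cutFromRight [] xs = []
cutFromRight (k ∷ K) xs = drop (length xs ℕ.∸ k) xs ∷ cutFromRight K (take (length xs ℕ.∸ k) xs)

module _ (k : ℕ) (K xs : List ℕ) (e : sum (k ∷ K) ≡ length xs) where

  sum-take-∸ : sum K ≡ length (take (length xs ℕ.∸ k) xs)
  sum-take-∸ = trans (trans (sym (ℕₚ.m+n∸m≡n k (sum K))) (cong (ℕ._∸ k) e))
                     (sym (trans (Listₚ.length-take _ xs) (ℕₚ.m≤n⇒m⊓n≡m (ℕₚ.m∸n≤m (length xs) k))))

  length-drop-∸ : length (drop (length xs ℕ.∸ k) xs) ≡ k
  length-drop-∸ = trans (Listₚ.length-drop (length xs ℕ.∸ k) xs) (ℕₚ.m∸[m∸n]≡n (subst (k ≤_) e (ℕₚ.m≤m+n k (sum K))))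

blockSizes-cutFromRight : ∀ K xs → sum K ≡ length xs → map length (cutFromRight K xs) ≡ K
blockSizes-cutFromRight [] xs e = refl
blockSizes-cutFromRight (k ∷ K) xs e = cong₂ _∷_ (length-drop-∸ k K xs e) (blockSizes-cutFromRight K _ (sum-take-∸ k K xs e))

concat-cutFromRight-↭ : ∀ K xs → sum K ≡ length xs → concat (cutFromRight K xs) ↭ xs
concat-cutFromRight-↭ [] [] e = ↭-refl
concat-cutFromRight-↭ (k ∷ K) xs e =
  ↭-trans (↭ₚ.++⁺ˡ (drop m xs) (concat-cutFromRight-↭ K (take m xs) (sum-take-∸ k K xs e)))
  (↭-trans (↭ₚ.++-comm (drop m xs) (take m xs)) (↭-reflexive (Listₚ.take++drop≡id m xs)))
  where m = length xs ℕ.∸ k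

cutFromRight-⊆ : ∀ K xs {B} → B ∈ cutFromRight K xs → B ⊆ xs
cutFromRight-⊆ (k ∷ K) xs (here refl) = drop⊆ (length xs ℕ.∸ k) xs
cutFromRight-⊆ (k ∷ K) xs (there m) mz = take⊆ (length xs ℕ.∸ k) xs (cutFromRight-⊆ K _ m mz)

cutFromRight-blocks : ∀ K xs → Increasing xs → All (1 ≤_) K → sum K ≡ length xs → All Block (cutFromRight K xs)
cutFromRight-blocks [] xs _ _ _ = []
cutFromRight-blocks (k ∷ K) xs s (k≥1 ∷ ps) e =
  (length≥1⇒nonEmpty _ (subst (1 ≤_) (sym (length-drop-∸ k K xs e)) k≥1) , AllPairsₚ.drop⁺ (length xs ℕ.∸ k) s)
  ∷ cutFromRight-blocks K _ (AllPairsₚ.take⁺ (length xs ℕ.∸ k) s) ps (sum-take-∸ k K xs e)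

cutFromRight-Decreasing : ∀ K xs → Increasing xs → sum K ≡ length xs → DecreasingBlocks (cutFromRight K xs)
cutFromRight-Decreasing [] xs _ _ = []
cutFromRight-Decreasing (k ∷ K) xs s e =
  link (cutFromRight-Decreasing K (take m xs) (AllPairsₚ.take⁺ m s) (sum-take-∸ k K xs e))
  where
    m = length xs ℕ.∸ k
    drop≻ : ∀ {H} → H ∈ cutFromRight K (take m xs) → drop m xs ≻ H
    drop≻ mH ma mb = Increasing-++ (subst Increasing (sym (Listₚ.take++drop≡id m xs)) s) (cutFromRight-⊆ K (take m xs) mH mb) ma
    link : DecreasingBlocks (cutFromRight K (take m xs)) → DecreasingBlocks (drop m xs ∷ cutFromRight K (take m xs))
    link l with cutFromRight K (take m xs) | drop≻
    ... | [] | _ = [-]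
    ... | H ∷ L | d = d (here refl) ∷ l

decreasingComp : ℕ → List ℕ → List (List ℕ)
decreasingComp n K = cutFromRight K (oneTo n)


blockSizes : List (List ℕ) → List ℕ
blockSizes = map length

sum-blockSizes : ∀ u → sum (blockSizes u) ≡ length (concat u)
sum-blockSizes [] = refl
sum-blockSizes (S ∷ u) = trans (cong (length S ℕ.+_) (sum-blockSizes u)) (sym (Listₚ.length-++ S))

blockSizes-IsComposition : ∀ {n u} → u ∈ SetComps n → IsComposition n (blockSizes u)
blockSizes-IsComposition {n} {u} m =
  Allₚ.map⁺ (All.map (λ {S} (S≢[] , _) → nonEmpty⇒length≥1 S S≢[]) (proj₁ (∈-SetComps⁻ {n} m)))
  , trans (sum-blockSizes u) (trans (↭ₚ.↭-length (proj₂ (∈-SetComps⁻ {n} m))) (length-oneTo n))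

length≤sum : ∀ K → All (1 ≤_) K → length K ≤ sum K
length≤sum [] [] = z≤n
length≤sum (k ∷ K) (k≥1 ∷ ps) = ℕₚ.+-mono-≤ k≥1 (length≤sum K ps)

∈-SetComps⇒length≤ : ∀ {n u} → u ∈ SetComps n → length u ≤ n
∈-SetComps⇒length≤ {n} {u} m =
  let (ps , e) = blockSizes-IsComposition {n} m
  in subst₂ _≤_ (Listₚ.length-map length u) e (length≤sum (blockSizes u) ps)

module _ {n K} (K-comp : IsComposition n K) where

  private
    sum≡length : sum K ≡ length (oneTo n)
    sum≡length = trans (proj₂ K-comp) (sym (length-oneTo n))

  blockSizes-decreasingComp : blockSizes (decreasingComp n K) ≡ K
  blockSizes-decreasingComp = blockSizes-cutFromRight K (oneTo n) sum≡length

  decreasingComp∈SetComps : decreasingComp n K ∈ SetComps n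
  decreasingComp∈SetComps = ∈-SetComps⁺ {n} (cutFromRight-blocks K (oneTo n) (oneTo-Increasing n) (proj₁ K-comp) sum≡length
                                       , concat-cutFromRight-↭ K (oneTo n) sum≡length)

  refines-decreasingComp : ∀ {u} → u ∈ SetComps n → concat u ≡ concat (decreasingComp n K) →
                           u ≡ decreasingComp n K ⊎ length K < length u
  refines-decreasingComp {u} m e
    with refines-decreasing u (decreasingComp n K) (blocks-Increasing (∈-SetComps⁻ {n} m)) (All.map proj₁ (proj₁ (∈-SetComps⁻ {n} m)))
           (All.map proj₁ (proj₁ (∈-SetComps⁻ {n} decreasingComp∈SetComps)))
           (cutFromRight-Decreasing K (oneTo n) (oneTo-Increasing n) sum≡length) e
  ... | inj₁ u≡ = inj₁ u≡
  ... | inj₂ lt = inj₂ (subst (_< length u) (trans (sym (Listₚ.length-map length (decreasingComp n K))) (cong length blockSizes-decreasingComp)) lt)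

⌊⌋-true⇒ : ∀ {p} {P : Set p} (P? : Dec P) → ⌊ P? ⌋ ≡ true → P
⌊⌋-true⇒ (yes p) _ = p

⌊⌋-true : ∀ {p} {P : Set p} (P? : Dec P) → P → ⌊ P? ⌋ ≡ true
⌊⌋-true (yes _) _ = refl
⌊⌋-true (no ¬p) p = ⊥-elim (¬p p)

⌊⌋-false : ∀ {p} {P : Set p} (P? : Dec P) → ¬ P → ⌊ P? ⌋ ≡ false
⌊⌋-false (yes p) ¬p = ⊥-elim (¬p p)
⌊⌋-false (no _) _ = refl

eqN : List ℕ → List ℕ → Bool
eqN K I = ⌊ Listₚ.≡-dec ℕ._≟_ K I ⌋

eqN-true⇒≡ : ∀ {K I} → eqN K I ≡ true → K ≡ I
eqN-true⇒≡ {K} {I} = ⌊⌋-true⇒ (Listₚ.≡-dec ℕ._≟_ K I)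

eqN-refl : ∀ K → eqN K K ≡ true
eqN-refl K = ⌊⌋-true (Listₚ.≡-dec ℕ._≟_ K K) refl

≢⇒eqN-false : ∀ {K I} → K ≢ I → eqN K I ≡ false
≢⇒eqN-false {K} {I} = ⌊⌋-false (Listₚ.≡-dec ℕ._≟_ K I)

eqSC-true⇒≡ : ∀ {u v} → eqSC u v ≡ true → u ≡ v
eqSC-true⇒≡ {u} {v} = ⌊⌋-true⇒ (Listₚ.≡-dec (Listₚ.≡-dec ℕ._≟_) u v)

eqSC-refl : ∀ u → eqSC u u ≡ true
eqSC-refl u = ⌊⌋-true (Listₚ.≡-dec (Listₚ.≡-dec ℕ._≟_) u u) refl

≢⇒eqSC-false : ∀ {u v} → u ≢ v → eqSC u v ≡ false
≢⇒eqSC-false {u} {v} = ⌊⌋-false (Listₚ.≡-dec (Listₚ.≡-dec ℕ._≟_) u v)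

bool-ext : ∀ {x y : Bool} → (x ≡ true → y ≡ true) → (y ≡ true → x ≡ true) → x ≡ y
bool-ext {true} {true} _ _ = refl
bool-ext {true} {false} x⇒y _ = sym (x⇒y refl)
bool-ext {false} {true} _ y⇒x = y⇒x refl
bool-ext {false} {false} _ _ = refl

eqSC-injective : ∀ (h : List (List ℕ) → List (List ℕ)) a b → (h a ≡ h b → a ≡ b) → eqSC (h a) (h b) ≡ eqSC a b
eqSC-injective h a b inj = bool-ext (λ e → subst (λ z → eqSC z b ≡ true) (sym (inj (eqSC-true⇒≡ e))) (eqSC-refl b))
                                    (λ e → subst (λ z → eqSC (h z) (h b) ≡ true) (sym (eqSC-true⇒≡ e)) (eqSC-refl (h b)))

eqN-cons : ∀ a A b B → eqN (a ∷ A) (b ∷ B) ≡ ((a ≡ᵇ b) ∧ eqN A B)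
eqN-cons a A b B = bool-ext
  (λ e → let e′ = eqN-true⇒≡ e in
     subst (λ z → ((a ≡ᵇ z) ∧ eqN A B) ≡ true) (Listₚ.∷-injectiveˡ e′)
       (subst (λ Z → ((a ≡ᵇ a) ∧ eqN A Z) ≡ true) (Listₚ.∷-injectiveʳ e′)
         (trans (cong (_∧ eqN A A) (≡ᵇ-refl a)) (eqN-refl A))))
  (λ e → subst (λ Z → eqN (a ∷ A) Z ≡ true)
     (cong₂ _∷_ (≡ᵇ-true⇒≡ a b (∧-conicalˡ _ _ e)) (eqN-true⇒≡ (∧-conicalʳ (a ≡ᵇ b) _ e))) (eqN-refl (a ∷ A)))

eqN-map-[_] : ∀ x y → eqN x y ≡ eqSC (map [_] x) (map [_] y)
eqN-map-[_] x y = bool-ext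
  (λ e → subst (λ z → eqSC (map [_] x) (map [_] z) ≡ true) (eqN-true⇒≡ e) (eqSC-refl (map [_] x)))
  (λ e → subst (λ z → eqN x z ≡ true) (map-[]-injective x y (eqSC-true⇒≡ e)) (eqN-refl x))
  where
    map-[]-injective : ∀ (x y : List ℕ) → map [_] x ≡ map [_] y → x ≡ y
    map-[]-injective [] [] e = refl
    map-[]-injective (a ∷ x) (b ∷ y) e = cong₂ _∷_ (Listₚ.∷-injectiveˡ (Listₚ.∷-injectiveˡ e)) (map-[]-injective x y (Listₚ.∷-injectiveʳ e))

module FiniteSums {c ℓ} (R : Semiring c ℓ) where
  open Semiring R renaming (refl to ≈-refl; sym to ≈-sym; trans to ≈-trans)
  open import Relation.Binary.Reasoning.Setoid setoid
  open import Algebra.Properties.CommutativeSemigroup +-commutativeSemigroup using (interchange)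

  Σ[_]_ : List A → (A → Carrier) → Carrier
  Σ[ xs ] f = foldr _+_ 0# (map f xs)

  ite : Bool → Carrier → Carrier
  ite b x = if b then x else 0#

  Σ-cong : (xs : List A) {f g : A → Carrier} → (∀ x → x ∈ xs → f x ≈ g x) → Σ[ xs ] f ≈ Σ[ xs ] g
  Σ-cong [] h = ≈-refl
  Σ-cong (x ∷ xs) h = +-cong (h x (here refl)) (Σ-cong xs (λ y m → h y (there m)))

  Σ-++ : (xs ys : List A) (f : A → Carrier) → Σ[ xs ++ ys ] f ≈ Σ[ xs ] f + Σ[ ys ] f
  Σ-++ [] ys f = ≈-sym (+-identityˡ _)
  Σ-++ (x ∷ xs) ys f = ≈-trans (+-cong ≈-refl (Σ-++ xs ys f)) (≈-sym (+-assoc _ _ _))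

  Σ-+ : (xs : List A) (f g : A → Carrier) → Σ[ xs ] (λ x → f x + g x) ≈ Σ[ xs ] f + Σ[ xs ] g
  Σ-+ [] f g = ≈-sym (+-identityˡ _)
  Σ-+ (x ∷ xs) f g = ≈-trans (+-cong ≈-refl (Σ-+ xs f g)) (interchange _ _ _ _)

  Σ-*ˡ : (xs : List A) (a : Carrier) (f : A → Carrier) → Σ[ xs ] (λ x → a * f x) ≈ a * Σ[ xs ] f
  Σ-*ˡ [] a f = ≈-sym (zeroʳ a)
  Σ-*ˡ (x ∷ xs) a f = ≈-trans (+-cong ≈-refl (Σ-*ˡ xs a f)) (≈-sym (distribˡ a _ _))

  Σ-*ʳ : (xs : List A) (a : Carrier) (f : A → Carrier) → Σ[ xs ] (λ x → f x * a) ≈ Σ[ xs ] f * a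
  Σ-*ʳ [] a f = ≈-sym (zeroˡ a)
  Σ-*ʳ (x ∷ xs) a f = ≈-trans (+-cong ≈-refl (Σ-*ʳ xs a f)) (≈-sym (distribʳ a _ _))

  Σ-0 : (xs : List A) (f : A → Carrier) → (∀ x → x ∈ xs → f x ≈ 0#) → Σ[ xs ] f ≈ 0#
  Σ-0 [] f h = ≈-refl
  Σ-0 (x ∷ xs) f h = ≈-trans (+-cong (h x (here refl)) (Σ-0 xs f (λ y m → h y (there m)))) (+-identityˡ 0#)

  Σ-↭ : {xs ys : List A} (f : A → Carrier) → xs ↭ ys → Σ[ xs ] f ≈ Σ[ ys ] f
  Σ-↭ f p = ↭ₛ.foldr-commMonoid setoid +-isCommutativeMonoid (↭⇒↭ₛ′ isEquivalence (↭ₚ.map⁺ f p))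

  Σ-map : (xs : List A) (g : A → B) (f : B → Carrier) → Σ[ map g xs ] f ≈ Σ[ xs ] (λ x → f (g x))
  Σ-map xs g f = reflexive (cong (foldr _+_ 0#) (sym (Listₚ.map-∘ xs)))

  Σ-swap : (xs : List A) (ys : List B) (h : A → B → Carrier) →
    Σ[ xs ] (λ x → Σ[ ys ] (λ y → h x y)) ≈ Σ[ ys ] (λ y → Σ[ xs ] (λ x → h x y))
  Σ-swap [] ys h = ≈-sym (Σ-0 ys (λ _ → 0#) (λ _ _ → ≈-refl))
  Σ-swap (x ∷ xs) ys h = ≈-trans (+-cong ≈-refl (Σ-swap xs ys h)) (≈-sym (Σ-+ ys (h x) (λ y → Σ[ xs ] (λ x → h x y))))

  Σ-*-Σ : (xs : List A) (ys : List B) (h : A → Carrier) (k : B → Carrier) →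
    Σ[ xs ] h * Σ[ ys ] k ≈ Σ[ xs ] (λ x → Σ[ ys ] (λ y → h x * k y))
  Σ-*-Σ xs ys h k = ≈-trans (≈-sym (Σ-*ʳ xs _ h)) (Σ-cong xs (λ x _ → ≈-sym (Σ-*ˡ ys (h x) k)))

  Σ-concatMap : (h : A → List B) (f : B → Carrier) → ∀ xs →
                Σ[ concatMap h xs ] f ≈ Σ[ xs ] (λ x → Σ[ h x ] f)
  Σ-concatMap h f [] = ≈-refl
  Σ-concatMap h f (x ∷ xs) = ≈-trans (Σ-++ (h x) (concatMap h xs) f) (+-cong ≈-refl (Σ-concatMap h f xs))

  foldr-++ : ∀ xs ys → foldr _+_ 0# (xs ++ ys) ≈ foldr _+_ 0# xs + foldr _+_ 0# ys
  foldr-++ [] ys = ≈-sym (+-identityˡ _)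
  foldr-++ (x ∷ xs) ys = ≈-trans (+-cong ≈-refl (foldr-++ xs ys)) (≈-sym (+-assoc _ _ _))

  foldr-concatMap : (h : A → List Carrier) → ∀ xs → foldr _+_ 0# (concatMap h xs) ≈ Σ[ xs ] (λ x → foldr _+_ 0# (h x))
  foldr-concatMap h [] = ≈-refl
  foldr-concatMap h (x ∷ xs) = ≈-trans (foldr-++ (h x) (concatMap h xs)) (+-cong ≈-refl (foldr-concatMap h xs))

  ite-true : ∀ {b} x → b ≡ true → ite b x ≈ x
  ite-true x refl = ≈-refl

  ite-false : ∀ {b} x → b ≡ false → ite b x ≈ 0#
  ite-false x refl = ≈-refl

  ite-0 : ∀ b → ite b 0# ≈ 0#
  ite-0 true = ≈-refl
  ite-0 false = ≈-refl

  ite-cong : ∀ b {x y} → x ≈ y → ite b x ≈ ite b y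
  ite-cong true e = e
  ite-cong false e = ≈-refl

  ite-*ˡ : ∀ b x y → ite b x * y ≈ ite b (x * y)
  ite-*ˡ true x y = ≈-refl
  ite-*ˡ false x y = zeroˡ y

  ite-*ʳ : ∀ b x y → y * ite b x ≈ ite b (y * x)
  ite-*ʳ true x y = ≈-refl
  ite-*ʳ false x y = zeroʳ y

  ite-*-ite : ∀ b d x y → ite b x * ite d y ≈ ite b (ite d (x * y))
  ite-*-ite b d x y = ≈-trans (ite-*ˡ b x (ite d y)) (ite-cong b (ite-*ʳ d y x))

  ite-+ : ∀ b x y → ite b (x + y) ≈ ite b x + ite b y
  ite-+ true x y = ≈-refl
  ite-+ false x y = ≈-sym (+-identityˡ 0#)

  ite-∧ : ∀ b d x → ite b (ite d x) ≈ ite (b ∧ d) x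
  ite-∧ true d x = ≈-refl
  ite-∧ false d x = ≈-refl

  ite-comm : ∀ b d x → ite b (ite d x) ≈ ite d (ite b x)
  ite-comm true true x = ≈-refl
  ite-comm true false x = ≈-refl
  ite-comm false true x = ≈-refl
  ite-comm false false x = ≈-refl

  ite-Σ : ∀ b (xs : List A) (h : A → Carrier) → ite b (Σ[ xs ] h) ≈ Σ[ xs ] (λ x → ite b (h x))
  ite-Σ true xs h = ≈-refl
  ite-Σ false xs h = ≈-sym (Σ-0 xs _ (λ _ _ → ≈-refl))

  Σ-ite-unique : (xs : List A) (b : A → Bool) (k : A → Carrier) → ∀ {x} → Unique xs → x ∈ xs → b x ≡ true →
    (∀ y → y ∈ xs → b y ≡ true → y ≡ x) → Σ[ xs ] (λ y → ite (b y) (k y)) ≈ k x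
  Σ-ite-unique (y ∷ xs) b k u (here refl) bx only-x =
    ≈-trans (+-cong (ite-true _ bx) (Σ-0 xs _ (λ z m → ite-false _ (b-false z m)))) (+-identityʳ _)
    where
      b-false : ∀ z → z ∈ xs → b z ≡ false
      b-false z m with b z in eq
      ... | true = ⊥-elim (Unique-head u (subst (_∈ xs) (only-x z (there m) eq) m))
      ... | false = refl
  Σ-ite-unique (y ∷ xs) b k (y∉ ∷ u) (there mx) bx only-x =
    ≈-trans (+-cong (ite-false _ by) (Σ-ite-unique xs b k u mx bx (λ z m e → only-x z (there m) e))) (+-identityˡ _)
    where
      by : b y ≡ false
      by with b y in eq
      ... | true = ⊥-elim (Unique-head (y∉ ∷ u) (subst (_∈ xs) (sym (only-x y (here refl) eq)) mx))
      ... | false = refl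

  Σ-ite-none : (xs : List A) (b : A → Bool) (k : A → Carrier) → (∀ y → y ∈ xs → b y ≡ false) →
    Σ[ xs ] (λ y → ite (b y) (k y)) ≈ 0#
  Σ-ite-none xs b k h = Σ-0 xs _ (λ y m → ite-false _ (h y m))
private
  concat-take-drop : ∀ i (w : List (List ℕ)) → concat w ≡ concat (take i w) ++ concat (drop i w)
  concat-take-drop i w = sym (trans (Listₚ.concat-++ (take i w) (drop i w)) (cong concat (Listₚ.take++drop≡id i w)))

Valid-take : ∀ i {w} → ValidSC w → ValidSC (take i w)
Valid-take i {w} (bl , u) = Allₚ.take⁺ i bl , Unique-++ˡ (subst Unique (concat-take-drop i w) u)

Valid-drop : ∀ i {w} → ValidSC w → ValidSC (drop i w)
Valid-drop i {w} (bl , u) = Allₚ.drop⁺ i bl , Unique-++ʳ {xs = concat (take i w)} (subst Unique (concat-take-drop i w) u)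

Valid⇒blockSizes-positive : ∀ {w} → ValidSC w → All (1 ≤_) (blockSizes w)
Valid⇒blockSizes-positive (bl , _) = Allₚ.map⁺ (All.map (λ {S} (S≢[] , _) → nonEmpty⇒length≥1 S S≢[]) bl)

take-drop-split : ∀ K I J i → i ≤ length K → (eqN (take i K) I ∧ eqN (drop i K) J) ≡ true → i ≡ length I × K ≡ I ++ J
take-drop-split K I J i i≤ e =
  let take≡ = eqN-true⇒≡ (∧-conicalˡ _ _ e)
      drop≡ = eqN-true⇒≡ (∧-conicalʳ (eqN (take i K) I) _ e)
  in trans (sym (ℕₚ.m≤n⇒m⊓n≡m i≤)) (trans (sym (Listₚ.length-take i K)) (cong length take≡))
   , trans (sym (Listₚ.take++drop≡id i K)) (cong₂ _++_ take≡ drop≡)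

module Representation {c ℓ} (F : Field c ℓ) where
  open Field F renaming (refl to ≈-refl; sym to ≈-sym; trans to ≈-trans)
  open Construction F
  open FiniteSums semiring
  open import Relation.Binary.Reasoning.Setoid setoid

  -- A term (c , K) stands for c · 1_K, where 1_K w = [blockSizes w = K] is the paper's basis element
  -- 1_{k₁} ∗ ⋯ ∗ 1_{kₘ} of 𝒟.
  Term : Set c
  Term = Carrier × List ℕ

  evalTerms : List Term → List ℕ → Carrier
  evalTerms L K = Σ[ L ] (λ t → ite (eqN K (proj₂ t)) (proj₁ t))

  RepresentedBy : T̂ → List Term → Set ℓ
  RepresentedBy f L = ∀ w → ValidSC w → f w ≈ evalTerms L (blockSizes w)

  one∅-rep : RepresentedBy one∅ ((1# , []) ∷ [])
  one∅-rep [] _ = ≈-sym (+-identityʳ 1#)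
  one∅-rep (S ∷ w) _ = ≈-sym (≈-trans (+-cong (ite-false 1# (≢⇒eqN-false {length S ∷ blockSizes w} {[]} λ ())) ≈-refl) (+-identityʳ 0#))

  oneN-rep : ∀ k → RepresentedBy (oneN k) ((1# , k ∷ []) ∷ [])
  oneN-rep k [] _ = ≈-sym (≈-trans (+-cong (ite-false 1# (≢⇒eqN-false {[]} {k ∷ []} λ ())) ≈-refl) (+-identityʳ 0#))
  oneN-rep k (S ∷ []) _ = subst (λ z → bool (length S ≡ᵇ k) ≈ ite z 1# + 0#) eqN-singleton (bool≈ite (length S ≡ᵇ k))
    where
      eqN-singleton : (length S ≡ᵇ k) ≡ eqN (length S ∷ []) (k ∷ [])
      eqN-singleton = sym (trans (eqN-cons (length S) [] k []) (∧-identityʳ _))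
      bool≈ite : ∀ z → bool z ≈ ite z 1# + 0#
      bool≈ite true = ≈-sym (+-identityʳ 1#)
      bool≈ite false = ≈-sym (+-identityʳ 0#)
  oneN-rep k (S ∷ T ∷ w) _ = ≈-sym (≈-trans (+-cong (ite-false 1# (≢⇒eqN-false {length S ∷ length T ∷ blockSizes w} {k ∷ []} λ ())) ≈-refl) (+-identityʳ 0#))

  ⊕-rep : ∀ {f g L₁ L₂} → RepresentedBy f L₁ → RepresentedBy g L₂ → RepresentedBy (f ⊕ g) (L₁ ++ L₂)
  ⊕-rep {L₁ = L₁} {L₂} r₁ r₂ w v = ≈-trans (+-cong (r₁ w v) (r₂ w v)) (≈-sym (Σ-++ L₁ L₂ _))

  scaleTerm : Carrier → Term → Term
  scaleTerm a t = a * proj₁ t , proj₂ t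

  ·-rep : ∀ a {f L} → RepresentedBy f L → RepresentedBy (a · f) (map (scaleTerm a) L)
  ·-rep a {f} {L} r w v = begin
    a * f w                                                      ≈⟨ *-cong ≈-refl (r w v) ⟩
    a * evalTerms L (blockSizes w)                               ≈⟨ ≈-sym (Σ-*ˡ L a _) ⟩
    Σ[ L ] (λ t → a * ite (eqN (blockSizes w) (proj₂ t)) (proj₁ t)) ≈⟨ Σ-cong L (λ t _ → ite-*ʳ _ _ a) ⟩
    Σ[ L ] (λ t → ite (eqN (blockSizes w) (proj₂ t)) (a * proj₁ t)) ≈⟨ ≈-sym (Σ-map L (scaleTerm a) _) ⟩
    evalTerms (map (scaleTerm a) L) (blockSizes w)               ∎

  ≐-rep : ∀ {f g L} → f ≐ g → RepresentedBy f L → RepresentedBy g L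
  ≐-rep f≐g r w v = ≈-trans (≈-sym (f≐g w v)) (r w v)

  -- The identity 1_I ∗ 1_J = 1_{I ++ J}.
  Σ-split-ite : ∀ K I J a b → Σ[ upTo (suc (length K)) ] (λ i → ite (eqN (take i K) I) a * ite (eqN (drop i K) J) b)
                           ≈ ite (eqN K (I ++ J)) (a * b)
  Σ-split-ite K I J a b =
    ≈-trans (Σ-cong positions (λ i _ → ≈-trans (ite-*-ite (eqN (take i K) I) (eqN (drop i K) J) a b)
                                                (ite-∧ (eqN (take i K) I) (eqN (drop i K) J) (a * b))))
            (by-cases (eqN K (I ++ J)) refl)
    where
      positions = upTo (suc (length K))
      splits-at : ℕ → Bool
      splits-at i = eqN (take i K) I ∧ eqN (drop i K) J
      by-cases : ∀ z → eqN K (I ++ J) ≡ z → Σ[ positions ] (λ i → ite (splits-at i) (a * b)) ≈ ite z (a * b)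
      by-cases true e with refl ← eqN-true⇒≡ e =
        Σ-ite-unique positions splits-at (λ _ → a * b) (Uniqueₚ.upTo⁺ _)
          (∈ₚ.∈-upTo⁺ (s≤s (subst (length I ≤_) (sym (Listₚ.length-++ I)) (ℕₚ.m≤m+n (length I) (length J)))))
          (subst (λ x → (x ∧ eqN (drop (length I) (I ++ J)) J) ≡ true)
                 (sym (trans (cong (λ X → eqN X I) (take-length-++ I J)) (eqN-refl I)))
                 (trans (cong (λ X → eqN X J) (drop-length-++ I J)) (eqN-refl J)))
          (λ i m e → proj₁ (take-drop-split (I ++ J) I J i (ℕₚ.≤-pred (∈ₚ.∈-upTo⁻ m)) e))
      by-cases false e = Σ-ite-none positions splits-at (λ _ → a * b) λ i m → not-split i (ℕₚ.≤-pred (∈ₚ.∈-upTo⁻ m))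
        where
          not-split : ∀ i → i ≤ length K → splits-at i ≡ false
          not-split i i≤ with splits-at i in e′
          ... | false = refl
          ... | true with () ← trans (sym (subst (λ X → eqN K X ≡ true) (proj₂ (take-drop-split K I J i i≤ e′)) (eqN-refl K))) e

  productTerm : Term → Term → Term
  productTerm t₁ t₂ = proj₁ t₁ * proj₁ t₂ , proj₂ t₁ ++ proj₂ t₂

  multiplyTerms : List Term → List Term → List Term
  multiplyTerms L₁ L₂ = concatMap (λ t₁ → map (productTerm t₁) L₂) L₁

  ∗-rep : ∀ {f g L₁ L₂} → RepresentedBy f L₁ → RepresentedBy g L₂ → RepresentedBy (f ∗ g) (multiplyTerms L₁ L₂)
  ∗-rep {f} {g} {L₁} {L₂} r₁ r₂ w v = begin
    (f ∗ g) w
      ≈⟨ Σ-cong (upTo (suc (length w))) (λ i _ → *-cong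
           (≈-trans (r₁ _ (Valid-take i v)) (reflexive (cong (evalTerms L₁) (sym (Listₚ.take-map i w)))))
           (≈-trans (r₂ _ (Valid-drop i v)) (reflexive (cong (evalTerms L₂) (sym (Listₚ.drop-map i w)))))) ⟩
    Σ[ upTo (suc (length w)) ] (λ i → evalTerms L₁ (take i K) * evalTerms L₂ (drop i K))
      ≡⟨ cong (λ l → Σ[ upTo (suc l) ] (λ i → evalTerms L₁ (take i K) * evalTerms L₂ (drop i K))) (sym (Listₚ.length-map length w)) ⟩
    Σ[ positions ] (λ i → evalTerms L₁ (take i K) * evalTerms L₂ (drop i K))
      ≈⟨ Σ-cong positions (λ i _ → Σ-*-Σ L₁ L₂ _ _) ⟩
    Σ[ positions ] (λ i → Σ[ L₁ ] (λ t₁ → Σ[ L₂ ] (λ t₂ → prefix t₁ i * suffix t₂ i)))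
      ≈⟨ Σ-swap positions L₁ _ ⟩
    Σ[ L₁ ] (λ t₁ → Σ[ positions ] (λ i → Σ[ L₂ ] (λ t₂ → prefix t₁ i * suffix t₂ i)))
      ≈⟨ Σ-cong L₁ (λ t₁ _ → Σ-swap positions L₂ _) ⟩
    Σ[ L₁ ] (λ t₁ → Σ[ L₂ ] (λ t₂ → Σ[ positions ] (λ i → prefix t₁ i * suffix t₂ i)))
      ≈⟨ Σ-cong L₁ (λ t₁ _ → Σ-cong L₂ (λ t₂ _ → Σ-split-ite K (proj₂ t₁) (proj₂ t₂) (proj₁ t₁) (proj₁ t₂))) ⟩
    Σ[ L₁ ] (λ t₁ → Σ[ L₂ ] (λ t₂ → ite (eqN K (proj₂ t₁ ++ proj₂ t₂)) (proj₁ t₁ * proj₁ t₂)))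
      ≈⟨ Σ-cong L₁ (λ t₁ _ → ≈-sym (Σ-map L₂ _ _)) ⟩
    Σ[ L₁ ] (λ t₁ → Σ[ map (productTerm t₁) L₂ ] (λ t → ite (eqN K (proj₂ t)) (proj₁ t)))
      ≈⟨ ≈-sym (Σ-concatMap _ _ L₁) ⟩
    evalTerms (multiplyTerms L₁ L₂) K ∎
    where
      K = blockSizes w
      positions = upTo (suc (length K))
      prefix : Term → ℕ → Carrier
      prefix t i = ite (eqN (take i K) (proj₂ t)) (proj₁ t)
      suffix : Term → ℕ → Carrier
      suffix t i = ite (eqN (drop i K) (proj₂ t)) (proj₁ t)

  InD⇒rep : ∀ {f} → InD f → Σ (List Term) (RepresentedBy f)
  InD⇒rep unitD = (1# , []) ∷ [] , one∅-rep
  InD⇒rep (genD k _) = (1# , k ∷ []) ∷ [] , oneN-rep k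
  InD⇒rep (addD d₁ d₂) = let (L₁ , r₁) = InD⇒rep d₁ ; (L₂ , r₂) = InD⇒rep d₂ in L₁ ++ L₂ , ⊕-rep {L₁ = L₁} r₁ r₂
  InD⇒rep (scalD a d) = let (L , r) = InD⇒rep d in map (scaleTerm a) L , ·-rep a {L = L} r
  InD⇒rep (mulD d₁ d₂) = let (L₁ , r₁) = InD⇒rep d₁ ; (L₂ , r₂) = InD⇒rep d₂ in multiplyTerms L₁ L₂ , ∗-rep {L₁ = L₁} {L₂} r₁ r₂
  InD⇒rep (respD f≐g d) = let (L , r) = InD⇒rep d in L , ≐-rep {L = L} f≐g r

  InD-blockSizes-invariant : ∀ {f} → InD f → ∀ u u′ → ValidSC u → ValidSC u′ → blockSizes u ≡ blockSizes u′ → f u ≈ f u′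
  InD-blockSizes-invariant d u u′ v v′ e =
    let (L , r) = InD⇒rep d in ≈-trans (r u v) (≈-trans (reflexive (cong (evalTerms L) e)) (≈-sym (r u′ v′)))
-- Triangularity: a function of compositions is determined by its sums over the set compositions
-- with a given reading word, because the decreasing set composition of type K is the least refined
-- set composition with its reading word.
module Triangularity {c ℓ} (R : Semiring c ℓ) (n : ℕ) where
  open Semiring R renaming (refl to ≈-refl; sym to ≈-sym; trans to ≈-trans)
  open FiniteSums R
  open import Relation.Binary.Reasoning.Setoid setoid

  readingSum : (List ℕ → Carrier) → List ℕ → Carrier
  readingSum H π = Σ[ SetComps n ] (λ u → ite (eqN (concat u) π) (H (blockSizes u)))

  module _ (H : List ℕ → Carrier) (readingSum≈0 : ∀ π → π ∈ allPerms n → readingSum H π ≈ 0#) where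

    vanishes-if-finer-vanish : ∀ K → IsComposition n K →
      (∀ u → u ∈ SetComps n → length K < length u → H (blockSizes u) ≈ 0#) → H K ≈ 0#
    vanishes-if-finer-vanish K K-comp finer≈0 = begin
      H K                                                   ≈⟨ ≈-sym (Σ-ite-unique (SetComps n) (λ u → eqSC u x) (λ _ → H K)
                                                                 (SetComps-Unique n) x∈ (eqSC-refl x) (λ y _ → eqSC-true⇒≡)) ⟩
      Σ[ SetComps n ] (λ u → ite (eqSC u x) (H K))          ≈⟨ Σ-cong (SetComps n) only-x ⟩
      readingSum H (concat x)                               ≈⟨ readingSum≈0 (concat x) (∈-allPerms⁺ (proj₂ (∈-SetComps⁻ {n} x∈))) ⟩
      0#                                                    ∎
      where
        x = decreasingComp n K
        x∈ = decreasingComp∈SetComps K-comp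
        only-x : ∀ u → u ∈ SetComps n → ite (eqSC u x) (H K) ≈ ite (eqN (concat u) (concat x)) (H (blockSizes u))
        only-x u mu with eqN (concat u) (concat x) in same-reading
        ... | false = ite-false (H K) (≢⇒eqSC-false λ { refl → contradiction (trans (sym same-reading) (eqN-refl _)) λ () })
        ... | true with refines-decreasingComp K-comp mu (eqN-true⇒≡ same-reading)
        ...   | inj₁ refl = ≈-trans (ite-true _ (eqSC-refl x)) (reflexive (cong H (sym (blockSizes-decreasingComp K-comp))))
        ...   | inj₂ K<u = ≈-trans (ite-false (H K) (≢⇒eqSC-false λ { refl → ℕₚ.<-irrefl length≡ K<u })) (≈-sym (finer≈0 u mu K<u))
          where
            length≡ : length K ≡ length x
            length≡ = trans (cong length (sym (blockSizes-decreasingComp K-comp))) (Listₚ.length-map length x)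

    -- Downward induction on the number of parts, which is at most n.
    readingSum≈0⇒≈0 : ∀ K → IsComposition n K → H K ≈ 0#
    readingSum≈0⇒≈0 K K-comp = below (n ℕ.∸ length K) K K-comp ℕₚ.≤-refl
      where
        below : ∀ d K → IsComposition n K → n ℕ.∸ length K ≤ d → H K ≈ 0#
        below d K K-comp ≤d = vanishes-if-finer-vanish K K-comp (λ u mu K<u → finer d u mu K<u ≤d)
          where
            finer : ∀ d u → u ∈ SetComps n → length K < length u → n ℕ.∸ length K ≤ d → H (blockSizes u) ≈ 0#
            finer zero u mu K<u ≤0 = ⊥-elim (ℕₚ.n≮0 (ℕₚ.≤-trans (ℕₚ.∸-monoʳ-< K<u (∈-SetComps⇒length≤ {n} mu)) ≤0))
            finer (suc d) u mu K<u ≤d = below d (blockSizes u) (blockSizes-IsComposition {n} mu)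
              (subst (λ l → n ℕ.∸ l ≤ d) (sym (Listₚ.length-map length u)) (ℕₚ.≤-pred (ℕₚ.≤-trans (ℕₚ.∸-monoʳ-< K<u (∈-SetComps⇒length≤ {n} mu)) ≤d)))
module DescentMap {c ℓ} (F : Field c ℓ) (n : ℕ) where
  open Field F renaming (refl to ≈-refl; sym to ≈-sym; trans to ≈-trans)
  open Construction F
  open FiniteSums semiring
  open Representation F
  open Triangularity semiring n
  open import Relation.Binary.Reasoning.Setoid setoid

  φ : T̂ → KS
  φ f π = Σ[ SetComps n ] (λ u → ite (eqN (concat u) π) (f u))

  φ-cong : ∀ f g → f ≐ g → EqP n (φ f) (φ g)
  φ-cong f g f≐g π _ = Σ-cong (SetComps n) (λ u m → ite-cong _ (f≐g u (∈-SetComps⇒Valid {n} m)))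

  φ-⊕ : ∀ f g → EqP n (φ (f ⊕ g)) (φ f ⊕ₚ φ g)
  φ-⊕ f g π _ = ≈-trans (Σ-cong (SetComps n) (λ u _ → ite-+ _ _ _)) (Σ-+ (SetComps n) _ _)

  φ-· : ∀ a f → EqP n (φ (a · f)) (a ·ₚ φ f)
  φ-· a f π _ = ≈-trans (Σ-cong (SetComps n) (λ u _ → ≈-sym (ite-*ʳ _ _ a))) (Σ-*ˡ (SetComps n) a _)

  φ-readingSum : ∀ {f L} → RepresentedBy f L → ∀ π → φ f π ≈ readingSum (evalTerms L) π
  φ-readingSum r π = Σ-cong (SetComps n) (λ u m → ite-cong (eqN (concat u) π) (r u (∈-SetComps⇒Valid {n} m)))

  φ-indicator : List ℕ → KS
  φ-indicator I = readingSum (λ K → ite (eqN K I) 1#)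

  φ-rep : ∀ {f L} → RepresentedBy f L → ∀ π → φ f π ≈ Σ[ L ] (λ t → proj₁ t * φ-indicator (proj₂ t) π)
  φ-rep {f} {L} r π = begin
    φ f π
      ≈⟨ φ-readingSum {L = L} r π ⟩
    Σ[ SetComps n ] (λ u → ite (eqN (concat u) π) (evalTerms L (blockSizes u)))
      ≈⟨ Σ-cong (SetComps n) (λ u _ → ite-Σ (eqN (concat u) π) L _) ⟩
    Σ[ SetComps n ] (λ u → Σ[ L ] (λ t → ite (eqN (concat u) π) (ite (eqN (blockSizes u) (proj₂ t)) (proj₁ t))))
      ≈⟨ Σ-swap (SetComps n) L _ ⟩
    Σ[ L ] (λ t → Σ[ SetComps n ] (λ u → ite (eqN (concat u) π) (ite (eqN (blockSizes u) (proj₂ t)) (proj₁ t))))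
      ≈⟨ Σ-cong L (λ t _ → ≈-trans (Σ-cong (SetComps n) (λ u _ → ite-cong (eqN (concat u) π) (ite-scale (eqN (blockSizes u) (proj₂ t)) (proj₁ t))))
                                    (≈-trans (Σ-cong (SetComps n) (λ u _ → ≈-sym (ite-*ʳ (eqN (concat u) π) _ (proj₁ t)))) (Σ-*ˡ (SetComps n) (proj₁ t) _))) ⟩
    Σ[ L ] (λ t → proj₁ t * φ-indicator (proj₂ t) π) ∎
    where
      ite-scale : ∀ b x → ite b x ≈ x * ite b 1#
      ite-scale true x = ≈-sym (*-identityʳ x)
      ite-scale false x = ≈-sym (zeroʳ x)

  -- φ(1_I) = D_I: the set compositions of type I reading π are just cut I π, which is one iff π
  -- has its descents among the partial sums of I.
  φ-indicator≈DC : ∀ I π → π ∈ allPerms n → IsComposition n I → φ-indicator I π ≈ DC I π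
  φ-indicator≈DC I π mπ I-comp@(_ , e) =
    ≈-trans (Σ-cong (SetComps n) (λ u _ → ite-∧ (eqN (concat u) π) (eqN (blockSizes u) I) 1#)) (by-cases (descentsWithin I π) refl)
    where
      π↭ = ∈-allPerms⁻ mπ
      sum≡length : sum I ≡ length π
      sum≡length = trans e (sym (trans (↭ₚ.↭-length π↭) (length-oneTo n)))
      reads-π-of-type-I : List (List ℕ) → Bool
      reads-π-of-type-I u = eqN (concat u) π ∧ eqN (blockSizes u) I
      ≡cut : ∀ u → reads-π-of-type-I u ≡ true → u ≡ cut I π
      ≡cut u e = trans (sym (cut-concat u)) (cong₂ cut (eqN-true⇒≡ (∧-conicalʳ (eqN (concat u) π) _ e)) (eqN-true⇒≡ (∧-conicalˡ _ _ e)))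
      cut-reads : reads-π-of-type-I (cut I π) ≡ true
      cut-reads rewrite concat-cut I π sum≡length | blockSizes-cut I π sum≡length | eqN-refl π | eqN-refl I = refl
      by-cases : ∀ z → descentsWithin I π ≡ z → Σ[ SetComps n ] (λ u → ite (reads-π-of-type-I u) 1#) ≈ bool z
      by-cases true ok = Σ-ite-unique (SetComps n) reads-π-of-type-I (λ _ → 1#) (SetComps-Unique n) (cut∈SetComps π↭ I-comp ok) cut-reads (λ y _ → ≡cut y)
      by-cases false not-ok = Σ-ite-none (SetComps n) reads-π-of-type-I (λ _ → 1#) λ u m → not-reads u m
        where
          not-reads : ∀ u → u ∈ SetComps n → reads-π-of-type-I u ≡ false
          not-reads u m with reads-π-of-type-I u in reads
          ... | false = refl
          ... | true with () ← trans (sym not-ok) (cut∈SetComps⇒descentsWithin π↭ I-comp (subst (_∈ SetComps n) (≡cut u reads) m))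

  φ-indicator≈0 : ∀ I π → ¬ IsComposition n I → φ-indicator I π ≈ 0#
  φ-indicator≈0 I π not-comp = Σ-0 (SetComps n) _ λ u m → ≈-trans (ite-cong (eqN (concat u) π) (not-type u m)) (ite-0 _)
    where
      not-type : ∀ u → u ∈ SetComps n → ite (eqN (blockSizes u) I) 1# ≈ 0#
      not-type u m with eqN (blockSizes u) I in e
      ... | false = ≈-refl
      ... | true = ⊥-elim (not-comp (subst (IsComposition n) (eqN-true⇒≡ e) (blockSizes-IsComposition {n} m)))

  IsComposition? : ∀ I → Dec (IsComposition n I)
  IsComposition? I = All.all? (1 ℕₚ.≤?_) I ×-dec (sum I ℕₚ.≟ n)

  φ-indicator-InDesc : ∀ I → InDesc n (φ-indicator I)
  φ-indicator-InDesc I with IsComposition? I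
  ... | yes comp = respC (λ π m → ≈-sym (φ-indicator≈DC I π m comp)) (genC I comp)
  ... | no not-comp = respC (λ π _ → ≈-sym (φ-indicator≈0 I π not-comp)) zeroC

  φ-InDesc : ∀ f → InDn n f → InDesc n (φ f)
  φ-InDesc f (d , _) = let (L , r) = InD⇒rep d in respC (λ π _ → ≈-sym (φ-rep {L = L} r π)) (terms-InDesc L)
    where
      terms-InDesc : ∀ L → InDesc n (λ π → Σ[ L ] (λ t → proj₁ t * φ-indicator (proj₂ t) π))
      terms-InDesc [] = zeroC
      terms-InDesc (t ∷ L) = addC (scalC (proj₁ t) (φ-indicator-InDesc (proj₂ t))) (terms-InDesc L)

  oneProduct : List ℕ → T̂
  oneProduct [] = one∅
  oneProduct (k ∷ C) = oneN k ∗ oneProduct C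

  oneProduct-rep : ∀ C → RepresentedBy (oneProduct C) ((1# , C) ∷ [])
  oneProduct-rep [] = one∅-rep
  oneProduct-rep (k ∷ C) w v = ≈-trans (∗-rep {L₁ = (1# , k ∷ []) ∷ []} {L₂ = (1# , C) ∷ []} (oneN-rep k) (oneProduct-rep C) w v) (+-cong (ite-cong _ (*-identityˡ 1#)) ≈-refl)

  oneProduct-InD : ∀ C → All (1 ≤_) C → InD (oneProduct C)
  oneProduct-InD [] [] = unitD
  oneProduct-InD (k ∷ C) (k≥1 ∷ ps) = mulD (genD k k≥1) (oneProduct-InD C ps)

  surjective : ∀ a → InDesc n a → Σ T̂ λ f → InDn n f × EqP n (φ f) a
  surjective _ (genC C C-comp@(ps , e)) = oneProduct C , (oneProduct-InD C ps , sized) , φ≈DC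
    where
      sized : ∀ w → ValidSC w → ¬ (size w ≡ n) → oneProduct C w ≈ 0#
      sized w v size≢n = ≈-trans (oneProduct-rep C w v)
        (≈-trans (+-identityʳ _) (ite-false 1# (≢⇒eqN-false λ { refl → size≢n e })))
      φ≈DC : EqP n (φ (oneProduct C)) (DC C)
      φ≈DC π m = ≈-trans (φ-rep {L = (1# , C) ∷ []} (oneProduct-rep C) π)
                   (≈-trans (+-identityʳ _) (≈-trans (*-identityˡ _) (φ-indicator≈DC C π m C-comp)))
  surjective _ zeroC = 0# · one∅ , (scalD 0# unitD , (λ _ _ _ → zeroˡ _)) ,
    (λ π _ → Σ-0 (SetComps n) _ (λ u _ → ≈-trans (ite-cong (eqN (concat u) π) (zeroˡ _)) (ite-0 _)))
  surjective _ (addC d₁ d₂) =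
    let (f₁ , (i₁ , s₁) , e₁) = surjective _ d₁ ; (f₂ , (i₂ , s₂) , e₂) = surjective _ d₂ in
    f₁ ⊕ f₂ , (addD i₁ i₂ , (λ w v ≢n → ≈-trans (+-cong (s₁ w v ≢n) (s₂ w v ≢n)) (+-identityʳ 0#))) ,
    (λ π m → ≈-trans (φ-⊕ f₁ f₂ π m) (+-cong (e₁ π m) (e₂ π m)))
  surjective _ (scalC x d) =
    let (f , (i , s) , e) = surjective _ d in
    x · f , (scalD x i , (λ w v ≢n → ≈-trans (*-cong ≈-refl (s w v ≢n)) (zeroʳ x))) ,
    (λ π m → ≈-trans (φ-· x f π m) (*-cong ≈-refl (e π m)))
  surjective _ (respC a≈b d) =
    let (f , p , e) = surjective _ d in f , p , (λ π m → ≈-trans (e π m) (a≈b π m))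

  injective : ∀ f g → InDn n f → InDn n g → EqP n (φ f) (φ g) → f ≐ g
  injective f g (df , f-sized) (dg , g-sized) φf≈φg w v with size w ℕₚ.≟ n
  ... | no size≢n = ≈-trans (f-sized w v size≢n) (≈-sym (g-sized w v size≢n))
  ... | yes size≡n = x∙y⁻¹≈ε⇒x≈y (f w) (g w) (begin
      f w - g w                     ≈⟨ +-cong ≈-refl (≈-sym (-1*x≈-x (g w))) ⟩
      (f ⊕ ((- 1#) · g)) w          ≈⟨ r w v ⟩
      evalTerms L (blockSizes w)    ≈⟨ readingSum≈0⇒≈0 (evalTerms L) readingSum≈0 (blockSizes w) (Valid⇒blockSizes-positive v , size≡n) ⟩
      0#                            ∎)
    where
      open import Algebra.Properties.Ring ring using (-1*x≈-x)
      open import Algebra.Properties.Group +-group using (x∙y⁻¹≈ε⇒x≈y)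
      L = proj₁ (InD⇒rep (addD df (scalD (- 1#) dg)))
      r = proj₂ (InD⇒rep (addD df (scalD (- 1#) dg)))
      readingSum≈0 : ∀ π → π ∈ allPerms n → readingSum (evalTerms L) π ≈ 0#
      readingSum≈0 π m = begin
        readingSum (evalTerms L) π    ≈⟨ ≈-sym (φ-readingSum {L = L} r π) ⟩
        φ (f ⊕ ((- 1#) · g)) π        ≈⟨ ≈-trans (φ-⊕ f _ π m) (+-cong ≈-refl (φ-· (- 1#) g π m)) ⟩
        φ f π + (- 1#) * φ g π        ≈⟨ +-cong ≈-refl (≈-trans (-1*x≈-x _) (-‿cong (≈-sym (φf≈φg π m)))) ⟩
        φ f π - φ f π                 ≈⟨ -‿inverseʳ _ ⟩
        0#                            ∎
module Multiplicativity {c ℓ} (F : Field c ℓ) (n : ℕ) where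
  open Field F renaming (refl to ≈-refl; sym to ≈-sym; trans to ≈-trans)
  open Construction F
  open FiniteSums semiring
  open Representation F
  open DescentMap F n
  open import Relation.Binary.Reasoning.Setoid setoid

  ∘-expand : ∀ f g w → (f ∘ g) w ≈ Σ[ setComps (isort (concat w)) ] (λ u → Σ[ setComps (isort (concat w)) ] (λ v →
                                     ite (eqSC (meet u v) w) (f u * g v)))
  ∘-expand f g w = foldr-concatMap _ (setComps (isort (concat w)))

  𝒮 : List (List (List ℕ))
  𝒮 = SetComps n

  meetSum : T̂ → T̂ → List ℕ → Carrier
  meetSum f g π = Σ[ 𝒮 ] (λ u → Σ[ 𝒮 ] (λ v → ite (eqN (concat (meet u v)) π) (f u * g v)))

  φ-∘≈meetSum : ∀ f g π → φ (f ∘ g) π ≈ meetSum f g π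
  φ-∘≈meetSum f g π = begin
    φ (f ∘ g) π
      ≈⟨ Σ-cong 𝒮 (λ w mw → ite-cong (reads w) (≈-trans (∘-expand f g w)
           (reflexive (cong (λ U → Σ[ setComps U ] (λ u → Σ[ setComps U ] (λ v → term u v w)))
                            (isort-oneTo n {w} (proj₂ (∈-SetComps⁻ {n} mw))))))) ⟩
    Σ[ 𝒮 ] (λ w → ite (reads w) (Σ[ 𝒮 ] (λ u → Σ[ 𝒮 ] (λ v → term u v w))))
      ≈⟨ Σ-cong 𝒮 (λ w _ → ≈-trans (ite-Σ (reads w) 𝒮 _) (Σ-cong 𝒮 (λ u _ → ite-Σ (reads w) 𝒮 _))) ⟩
    Σ[ 𝒮 ] (λ w → Σ[ 𝒮 ] (λ u → Σ[ 𝒮 ] (λ v → ite (reads w) (term u v w))))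
      ≈⟨ ≈-trans (Σ-swap 𝒮 𝒮 _) (Σ-cong 𝒮 (λ u _ → Σ-swap 𝒮 𝒮 _)) ⟩
    Σ[ 𝒮 ] (λ u → Σ[ 𝒮 ] (λ v → Σ[ 𝒮 ] (λ w → ite (reads w) (term u v w))))
      ≈⟨ Σ-cong 𝒮 (λ u mu → Σ-cong 𝒮 (λ v mv → ≈-trans (Σ-cong 𝒮 (λ w _ → ite-comm (reads w) (eqSC (meet u v) w) _))
           (Σ-ite-unique 𝒮 (eqSC (meet u v)) (λ w → ite (reads w) (f u * g v)) (SetComps-Unique n)
              (∈-SetComps⁺ {n} (meet-IsSetComposition (oneTo-Increasing n) (∈-SetComps⁻ {n} mu) (∈-SetComps⁻ {n} mv)))
              (eqSC-refl (meet u v)) (λ y _ e → sym (eqSC-true⇒≡ e))))) ⟩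
    meetSum f g π ∎
    where
      reads : List (List ℕ) → Bool
      reads w = eqN (concat w) π
      term : List (List ℕ) → List (List ℕ) → List (List ℕ) → Carrier
      term u v w = ite (eqSC (meet u v) w) (f u * g v)

  productSum : T̂ → T̂ → List ℕ → Carrier
  productSum f g π = Σ[ 𝒮 ] (λ u → Σ[ 𝒮 ] (λ v → ite (eqSC (map [_] (mulPerm (concat u) (concat v))) (map [_] π)) (f u * g v)))

  Pn : List (List ℕ)
  Pn = allPerms n

  Σ-readings : ∀ (b : List ℕ → List ℕ → Bool) {u v} → u ∈ 𝒮 → v ∈ 𝒮 → ∀ x →
    Σ[ Pn ] (λ σ → Σ[ Pn ] (λ τ → ite (b σ τ) (ite (eqN (concat u) σ) (ite (eqN (concat v) τ) x))))
    ≈ ite (b (concat u) (concat v)) x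
  Σ-readings b {u} {v} mu mv x = begin
    Σ[ Pn ] (λ σ → Σ[ Pn ] (λ τ → ite (b σ τ) (ite (reads u σ) (ite (reads v τ) x))))
      ≈⟨ Σ-cong Pn (λ σ _ → ≈-trans (Σ-cong Pn (λ τ _ → ≈-trans (ite-comm (b σ τ) (reads u σ) _)
           (ite-cong (reads u σ) (ite-comm (b σ τ) (reads v τ) _)))) (≈-sym (ite-Σ (reads u σ) Pn _))) ⟩
    Σ[ Pn ] (λ σ → ite (reads u σ) (Σ[ Pn ] (λ τ → ite (reads v τ) (ite (b σ τ) x))))
      ≈⟨ Σ-cong Pn (λ σ _ → ite-cong (reads u σ) (Σ-ite-unique Pn (reads v) (λ τ → ite (b σ τ) x)
           (allPerms-Unique n) (∈-allPerms⁺ (proj₂ (∈-SetComps⁻ {n} mv))) (eqN-refl (concat v)) (λ y _ e → sym (eqN-true⇒≡ e)))) ⟩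
    Σ[ Pn ] (λ σ → ite (reads u σ) (ite (b σ (concat v)) x))
      ≈⟨ Σ-ite-unique Pn (reads u) (λ σ → ite (b σ (concat v)) x) (allPerms-Unique n)
           (∈-allPerms⁺ (proj₂ (∈-SetComps⁻ {n} mu))) (eqN-refl (concat u)) (λ y _ e → sym (eqN-true⇒≡ e)) ⟩
    ite (b (concat u) (concat v)) x ∎
    where
      reads : List (List ℕ) → List ℕ → Bool
      reads u σ = eqN (concat u) σ

  mulKS≈productSum : ∀ f g π → mulKS n (φ f) (φ g) π ≈ productSum f g π
  mulKS≈productSum f g π = begin
    mulKS n (φ f) (φ g) π
      ≈⟨ foldr-concatMap _ Pn ⟩
    Σ[ Pn ] (λ σ → Σ[ Pn ] (λ τ → ite (product σ τ) (φ f σ * φ g τ)))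
      ≈⟨ Σ-cong Pn (λ σ _ → Σ-cong Pn (λ τ _ → ≈-trans (ite-cong (product σ τ) (≈-trans (Σ-*-Σ 𝒮 𝒮 _ _)
           (Σ-cong 𝒮 (λ u _ → Σ-cong 𝒮 (λ v _ → ite-*-ite (reads u σ) (reads v τ) (f u) (g v))))))
           (≈-trans (ite-Σ (product σ τ) 𝒮 _) (Σ-cong 𝒮 (λ u _ → ite-Σ (product σ τ) 𝒮 _))))) ⟩
    Σ[ Pn ] (λ σ → Σ[ Pn ] (λ τ → Σ[ 𝒮 ] (λ u → Σ[ 𝒮 ] (λ v → ite (product σ τ) (term σ τ u v)))))
      ≈⟨ ≈-trans (Σ-cong Pn (λ σ _ → Σ-swap Pn 𝒮 _)) (Σ-swap Pn 𝒮 _) ⟩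
    Σ[ 𝒮 ] (λ u → Σ[ Pn ] (λ σ → Σ[ Pn ] (λ τ → Σ[ 𝒮 ] (λ v → ite (product σ τ) (term σ τ u v)))))
      ≈⟨ Σ-cong 𝒮 (λ u _ → ≈-trans (Σ-cong Pn (λ σ _ → Σ-swap Pn 𝒮 _)) (Σ-swap Pn 𝒮 _)) ⟩
    Σ[ 𝒮 ] (λ u → Σ[ 𝒮 ] (λ v → Σ[ Pn ] (λ σ → Σ[ Pn ] (λ τ → ite (product σ τ) (term σ τ u v)))))
      ≈⟨ Σ-cong 𝒮 (λ u mu → Σ-cong 𝒮 (λ v mv → Σ-readings product mu mv (f u * g v))) ⟩
    productSum f g π ∎
    where
      product : List ℕ → List ℕ → Bool
      product σ τ = eqSC (map [_] (mulPerm σ τ)) (map [_] π)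
      reads : List (List ℕ) → List ℕ → Bool
      reads u σ = eqN (concat u) σ
      term : List ℕ → List ℕ → List (List ℕ) → List (List ℕ) → Carrier
      term σ τ u v = ite (reads u σ) (ite (reads v τ) (f u * g v))

  -- For fixed v, relabelling u by the permutation read off v turns meet-readings into products.
  meetSum≈productSum : ∀ f g → InD f → ∀ π → meetSum f g π ≈ productSum f g π
  meetSum≈productSum f g df π = ≈-trans (Σ-swap 𝒮 𝒮 _) (≈-trans (Σ-cong 𝒮 relabel-u) (Σ-swap 𝒮 𝒮 _))
    where
      relabel-u : ∀ v → v ∈ 𝒮 → Σ[ 𝒮 ] (λ u → ite (eqN (concat (meet u v)) π) (f u * g v))
                             ≈ Σ[ 𝒮 ] (λ u → ite (eqSC (map [_] (mulPerm (concat u) (concat v))) (map [_] π)) (f u * g v))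
      relabel-u v mv = begin
        Σ[ 𝒮 ] term               ≈⟨ Σ-↭ term (↭-sym map-relabel-↭) ⟩
        Σ[ map relabel 𝒮 ] term   ≈⟨ Σ-map 𝒮 relabel term ⟩
        Σ[ 𝒮 ] (λ u → term (relabel u))
          ≈⟨ Σ-cong 𝒮 (λ u mu → ≈-trans (reflexive (cong (λ z → ite z (f (relabel u) * g v))
                 (trans (cong (λ z → eqN z π) (concat-meet-relabel (∈-SetComps⁻ {n} mu) v-comp refl)) (eqN-map-[_] _ π))))
                 (ite-cong _ (*-cong (InD-blockSizes-invariant df (relabel u) u
                   (∈-SetComps⇒Valid {n} (∈-SetComps⁺ {n} (relabel-IsSetComposition (∈-SetComps⁻ {n} mu)))) (∈-SetComps⇒Valid {n} mu)
                   (blockSizes-relabel (∈-SetComps⁻ {n} mu))) ≈-refl))) ⟩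
        Σ[ 𝒮 ] (λ u → ite (eqSC (map [_] (mulPerm (concat u) (concat v))) (map [_] π)) (f u * g v)) ∎
        where
          v-comp = ∈-SetComps⁻ {n} mv
          open Relabel n (proj₂ v-comp)
          term : List (List ℕ) → Carrier
          term u = ite (eqN (concat (meet u v)) π) (f u * g v)

  φ-∘ : ∀ f g → InD f → EqP n (φ (f ∘ g)) (mulKS n (φ f) (φ g))
  φ-∘ f g df π _ = begin
    φ (f ∘ g) π             ≈⟨ φ-∘≈meetSum f g π ⟩
    meetSum f g π           ≈⟨ meetSum≈productSum f g df π ⟩
    productSum f g π        ≈⟨ ≈-sym (mulKS≈productSum f g π) ⟩
    mulKS n (φ f) (φ g) π   ∎
splitPair-map : (ℕ → ℕ) → List ℕ × List ℕ → List ℕ × List ℕ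
splitPair-map α (a , b) = map α a , map α b

splits-map : ∀ (α : ℕ → ℕ) xs → splits (map α xs) ≡ map (splitPair-map α) (splits xs)
splits-map α [] = refl
splits-map α (x ∷ xs) rewrite splits-map α xs = step (splits xs)
  where
    step : ∀ L → concatMap (splitStep (α x)) (map (splitPair-map α) L) ≡ map (splitPair-map α) (concatMap (splitStep x) L)
    step [] = refl
    step ((a , b) ∷ L) = cong (λ z → (α x ∷ map α a , map α b) ∷ (map α a , α x ∷ map α b) ∷ z) (step L)

setCompsF-map : ∀ (α : ℕ → ℕ) k xs → setCompsF k (map α xs) ≡ map (map (map α)) (setCompsF k xs)
setCompsF-map α k [] = refl
setCompsF-map α zero (x ∷ xs) = refl
setCompsF-map α (suc k) (x ∷ xs) rewrite splits-map α (x ∷ xs) = step (splits (x ∷ xs))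
  where
    first-block : ∀ a b → setCompStep k (map α a , map α b) ≡ map (map (map α)) (setCompStep k (a , b))
    first-block [] b = refl
    first-block (y ∷ a) b rewrite setCompsF-map α k b = trans (sym (Listₚ.map-∘ (setCompsF k b))) (Listₚ.map-∘ (setCompsF k b))
    step : ∀ L → concatMap (setCompStep k) (map (splitPair-map α) L) ≡ map (map (map α)) (concatMap (setCompStep k) L)
    step [] = refl
    step ((a , b) ∷ L) = trans (cong₂ _++_ (first-block a b) (step L))
                               (sym (Listₚ.map-++ (map (map α)) (setCompStep k (a , b)) (concatMap (setCompStep k) L)))

setComps-map : ∀ (α : ℕ → ℕ) xs → setComps (map α xs) ≡ map (map (map α)) (setComps xs)
setComps-map α xs = trans (cong (λ l → setCompsF l (map α xs)) (Listₚ.length-map α xs)) (setCompsF-map α (length xs) xs)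

blockSizes-map-map : ∀ (α : ℕ → ℕ) u → blockSizes (map (map α) u) ≡ blockSizes u
blockSizes-map-map α [] = refl
blockSizes-map-map α (S ∷ u) = cong₂ _∷_ (Listₚ.length-map α S) (blockSizes-map-map α u)

cut-Increasing : ∀ K xs → Increasing xs → All Increasing (cut K xs)
cut-Increasing [] xs s = []
cut-Increasing (k ∷ K) xs s = AllPairsₚ.take⁺ k s ∷ cut-Increasing K (drop k xs) (AllPairsₚ.drop⁺ k s)

cut-oneTo∈SetComps : ∀ {n K} → IsComposition n K → cut K (oneTo n) ∈ SetComps n
cut-oneTo∈SetComps {n} {K} (ps , e) = ∈-SetComps⁺ {n} (cut-IsSetComposition K (oneTo n) ps sum≡ (cut-Increasing K (oneTo n) (oneTo-Increasing n)) ↭-refl)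
  where sum≡ = trans e (sym (length-oneTo n))

-- The standard labelling of a valid symbol w by [size w]: w is the image of a set composition of
-- [size w] under the increasing bijection onto the underlying set of w.
module Standardize {w} (v : ValidSC w) where

  U : List ℕ
  U = isort (concat w)

  s : ℕ
  s = size w

  α : ℕ → ℕ
  α = at1 U

  U-Increasing : Increasing U
  U-Increasing = Valid⇒isort-Increasing v

  map-α-oneTo : map α (oneTo s) ≡ U
  map-α-oneTo = subst (λ k → map α (oneTo k) ≡ U)
                      (trans (↭ₚ.↭-length (isort-↭ (concat w))) (sym (sum-blockSizes w))) (map-at1-oneTo U)

  α-injective : InjectiveOn α (oneTo s)
  α-injective = Unique-map⁻-local α (subst Unique (sym map-α-oneTo) (Increasing⇒Unique U-Increasing))

  relabelα : List (List ℕ) → List (List ℕ)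
  relabelα = map (map α)

  setComps-U : setComps U ≡ map relabelα (SetComps s)
  setComps-U = trans (cong setComps (sym map-α-oneTo)) (setComps-map α (oneTo s))

  standard : Σ (List (List ℕ)) λ w̃ → w̃ ∈ SetComps s × w ≡ relabelα w̃
  standard = let (w̃ , m , e) = ∈ₚ.∈-map⁻ relabelα (subst (w ∈_) setComps-U (setComps-complete U U-Increasing (Valid⇒IsSetComposition v)))
             in w̃ , m , e

  relabelα-injective : ∀ a b → a ∈ SetComps s → b ∈ SetComps s → relabelα a ≡ relabelα b → a ≡ b
  relabelα-injective a b ma mb = map-injective-local (map α) (_⊆ oneTo s)
    (λ S S′ S⊆ S′⊆ → map-injective-local α (_∈ oneTo s) α-injective S S′ (All.tabulate S⊆) (All.tabulate S′⊆))
    a b (All.tabulate (block⊆ (∈-SetComps⁻ {s} ma))) (All.tabulate (block⊆ (∈-SetComps⁻ {s} mb)))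

  relabelα-Valid : ∀ u → u ∈ SetComps s → ValidSC (relabelα u)
  relabelα-Valid u mu = IsSetComposition⇒Valid U-Increasing U-positive
                          (setComps-sound U U-Increasing (subst (relabelα u ∈_) (sym setComps-U) (∈ₚ.∈-map⁺ relabelα mu)))
    where
      U-positive : All (1 ≤_) U
      U-positive = All.tabulate λ m → let (S , mz , mS) = ∈ₚ.∈-concat⁻′ w (↭ₚ.∈-resp-↭ (isort-↭ (concat w)) m) in
                                       All.lookup (proj₂ (proj₂ (All.lookup (proj₁ v) mS))) mz

  relabelα-meet : ∀ {u v} → u ∈ SetComps s → v ∈ SetComps s → meet (relabelα u) (relabelα v) ≡ relabelα (meet u v)
  relabelα-meet mu mv = meet-map-map α (oneTo s) α-injective _ _ (λ _ → block⊆ (∈-SetComps⁻ {s} mu)) (λ _ → block⊆ (∈-SetComps⁻ {s} mv))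

module Closure {c ℓ} (F : Field c ℓ) where
  open Field F renaming (refl to ≈-refl; sym to ≈-sym; trans to ≈-trans)
  open Construction F
  open FiniteSums semiring
  open Representation F
  open import Relation.Binary.Reasoning.Setoid setoid

  meetSumOver : T̂ → T̂ → ℕ → List (List ℕ) → Carrier
  meetSumOver f g s x = Σ[ SetComps s ] (λ u → Σ[ SetComps s ] (λ v → ite (eqSC (meet u v) x) (f u * g v)))

  module _ {f g} (df : InD f) (dg : InD g) where

    meetSumOver-relabel : ∀ s {τ} (τ↭ : τ ↭ oneTo s) x → x ∈ SetComps s → meetSumOver f g s (Relabel.relabel s τ↭ x) ≈ meetSumOver f g s x
    meetSumOver-relabel s τ↭ x mx = begin
      meetSumOver f g s (relabel x)
        ≈⟨ ≈-trans (reindex _) (Σ-cong (SetComps s) (λ u _ → reindex _)) ⟩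
      Σ[ SetComps s ] (λ u → Σ[ SetComps s ] (λ v → ite (eqSC (meet (relabel u) (relabel v)) (relabel x)) (f (relabel u) * g (relabel v))))
        ≈⟨ Σ-cong (SetComps s) (λ u mu → Σ-cong (SetComps s) (λ v mv → ≈-trans
             (reflexive (cong (λ z → ite z (f (relabel u) * g (relabel v)))
               (trans (cong (λ z → eqSC z (relabel x)) (relabel-meet (∈-SetComps⁻ {s} mu) (∈-SetComps⁻ {s} mv)))
                      (eqSC-injective relabel (meet u v) x
                        (relabel-injective (meet-IsSetComposition (oneTo-Increasing s) (∈-SetComps⁻ {s} mu) (∈-SetComps⁻ {s} mv)) (∈-SetComps⁻ {s} mx))))))
             (ite-cong _ (*-cong (invariant df mu) (invariant dg mv))))) ⟩
      meetSumOver f g s x ∎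
      where
        open Relabel s τ↭
        reindex : ∀ (t : List (List ℕ) → Carrier) → Σ[ SetComps s ] t ≈ Σ[ SetComps s ] (λ u → t (relabel u))
        reindex t = ≈-trans (Σ-↭ t (↭-sym map-relabel-↭)) (Σ-map (SetComps s) relabel t)
        invariant : ∀ {h} → InD h → ∀ {u} → u ∈ SetComps s → h (relabel u) ≈ h u
        invariant dh {u} mu = InD-blockSizes-invariant dh (relabel u) u
          (∈-SetComps⇒Valid {s} (∈-SetComps⁺ {s} (relabel-IsSetComposition (∈-SetComps⁻ {s} mu)))) (∈-SetComps⇒Valid {s} mu)
          (blockSizes-relabel (∈-SetComps⁻ {s} mu))

    meetSumOver-cut : ∀ s x → x ∈ SetComps s → meetSumOver f g s x ≈ meetSumOver f g s (cut (blockSizes x) (oneTo s))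
    meetSumOver-cut s x mx =
      ≈-trans (reflexive (cong (meetSumOver f g s) (sym (relabel-cut (∈-SetComps⁻ {s} mx) refl))))
              (meetSumOver-relabel s (proj₂ (∈-SetComps⁻ {s} mx)) (cut (blockSizes x) (oneTo s)) (cut-oneTo∈SetComps (blockSizes-IsComposition {s} mx)))
      where open Relabel s (proj₂ (∈-SetComps⁻ {s} mx))

    ∘-standard : ∀ w (v : ValidSC w) → let open Standardize v in (f ∘ g) w ≈ meetSumOver f g s (proj₁ standard)
    ∘-standard w v = begin
      (f ∘ g) w                                                         ≈⟨ foldr-concatMap _ (setComps U) ⟩
      Σ[ setComps U ] (λ u → Σ[ setComps U ] (λ v → term u v))           ≡⟨ cong (λ L → Σ[ L ] (λ u → Σ[ L ] (λ v → term u v))) setComps-U ⟩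
      Σ[ map relabelα (SetComps s) ] (λ u → Σ[ map relabelα (SetComps s) ] (λ v → term u v))
        ≈⟨ ≈-trans (Σ-map (SetComps s) relabelα _) (Σ-cong (SetComps s) (λ u _ → Σ-map (SetComps s) relabelα _)) ⟩
      Σ[ SetComps s ] (λ u → Σ[ SetComps s ] (λ v → term (relabelα u) (relabelα v)))
        ≈⟨ Σ-cong (SetComps s) (λ u mu → Σ-cong (SetComps s) (λ v mv → relabelα-term mu mv)) ⟩
      meetSumOver f g s w̃                                               ∎
      where
        open Standardize v
        w̃ = proj₁ standard
        term : List (List ℕ) → List (List ℕ) → Carrier
        term u v = ite (eqSC (meet u v) w) (f u * g v)
        relabelα-term : ∀ {u v} → u ∈ SetComps s → v ∈ SetComps s → term (relabelα u) (relabelα v) ≈ ite (eqSC (meet u v) w̃) (f u * g v)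
        relabelα-term {u} {v} mu mv = ≈-trans
          (reflexive (cong (λ z → ite z (f (relabelα u) * g (relabelα v)))
            (trans (cong₂ eqSC (relabelα-meet mu mv) (proj₂ (proj₂ standard)))
                   (eqSC-injective relabelα (meet u v) w̃ (relabelα-injective _ _
                      (∈-SetComps⁺ {s} (meet-IsSetComposition (oneTo-Increasing s) (∈-SetComps⁻ {s} mu) (∈-SetComps⁻ {s} mv))) (proj₁ (proj₂ standard)))))))
          (ite-cong _ (*-cong (invariant df mu) (invariant dg mv)))
          where
            invariant : ∀ {h} → InD h → ∀ {u} → u ∈ SetComps s → h (relabelα u) ≈ h u
            invariant dh {u} mu = InD-blockSizes-invariant dh (relabelα u) u (relabelα-Valid u mu) (∈-SetComps⇒Valid {s} mu) (blockSizes-map-map α u)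

    ∘-typeFunction : List ℕ → Carrier
    ∘-typeFunction K = meetSumOver f g (sum K) (cut K (oneTo (sum K)))

    ∘-by-type : ∀ w → ValidSC w → (f ∘ g) w ≈ ∘-typeFunction (blockSizes w)
    ∘-by-type w v = ≈-trans (∘-standard w v) (≈-trans (meetSumOver-cut s w̃ w̃∈) (reflexive (cong (λ K → meetSumOver f g s (cut K (oneTo s))) same-sizes)))
      where
        open Standardize v
        w̃ = proj₁ standard
        w̃∈ = proj₁ (proj₂ standard)
        same-sizes : blockSizes w̃ ≡ blockSizes w
        same-sizes = trans (sym (blockSizes-map-map α w̃)) (cong blockSizes (sym (proj₂ (proj₂ standard))))

    ∘-vanishes : ∀ w → ValidSC w → (∀ u → u ∈ SetComps (size w) → f u ≈ 0#) → (f ∘ g) w ≈ 0#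
    ∘-vanishes w v f≈0 = ≈-trans (∘-standard w v) (Σ-0 (SetComps (size w)) _ λ u mu → Σ-0 (SetComps (size w)) _ λ _ _ →
                           ≈-trans (ite-cong _ (≈-trans (*-cong (f≈0 u mu) ≈-refl) (zeroˡ _))) (ite-0 _))

  sumElements : List T̂ → T̂
  sumElements [] = 0# · one∅
  sumElements (x ∷ xs) = x ⊕ sumElements xs

  sumElements-map-InD : ∀ (h : ℕ → T̂) ks → (∀ k → k ∈ ks → InD (h k)) → InD (sumElements (map h ks))
  sumElements-map-InD h [] _ = scalD 0# unitD
  sumElements-map-InD h (k ∷ ks) h∈ = addD (h∈ k (here refl)) (sumElements-map-InD h ks (λ j m → h∈ j (there m)))

  sumElements-val : ∀ xs w → sumElements xs w ≈ Σ[ xs ] (λ x → x w)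
  sumElements-val [] w = zeroˡ _
  sumElements-val (x ∷ xs) w = +-cong ≈-refl (sumElements-val xs w)

  oneN∗-nil : ∀ k g → (oneN k ∗ g) [] ≈ 0#
  oneN∗-nil k g = ≈-trans (+-identityʳ _) (zeroˡ _)

  oneN∗-cons : ∀ k g S w → (oneN k ∗ g) (S ∷ w) ≈ ite (length S ≡ᵇ k) (g w)
  oneN∗-cons k g S w = ≈-trans (+-cong (zeroˡ _) (≈-trans (+-cong ≈-refl (longer-prefixes w)) (+-identityʳ _)))
                               (≈-trans (+-identityˡ _) (bool-* (length S ≡ᵇ k)))
    where
      bool-* : ∀ b → bool b * g w ≈ ite b (g w)
      bool-* true = *-identityˡ _
      bool-* false = zeroˡ _
      longer-prefixes : ∀ w → Σ[ applyUpTo (λ i → suc (suc i)) (length w) ] (λ i → oneN k (take i (S ∷ w)) * g (drop i (S ∷ w))) ≈ 0#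
      longer-prefixes [] = ≈-refl
      longer-prefixes (T ∷ w) = Σ-0 (applyUpTo (λ i → suc (suc i)) (length (T ∷ w))) _ λ i m →
        let (j , _ , e) = ∈ₚ.∈-applyUpTo⁻ (λ i → suc (suc i)) m in
        subst (λ i → oneN k (take i (S ∷ T ∷ w)) * g (drop i (S ∷ T ∷ w)) ≈ 0#) (sym e) (zeroˡ _)

  -- fromTypeFunction _ m H = Σ_K H K · 1_K over the compositions K of m, by recursion on the first part;
  -- the first argument is fuel for termination.
  fromTypeFunction : ℕ → ℕ → (List ℕ → Carrier) → T̂
  fromTypeFunction _ zero H = H [] · one∅
  fromTypeFunction zero (suc m) H = 0# · one∅
  fromTypeFunction (suc fuel) (suc m) H =
    sumElements (map (λ k → oneN k ∗ fromTypeFunction fuel (suc m ℕ.∸ k) (λ K → H (k ∷ K))) (oneTo (suc m)))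

  fromTypeFunction-InD : ∀ fuel m H → InD (fromTypeFunction fuel m H)
  fromTypeFunction-InD _ zero H = scalD (H []) unitD
  fromTypeFunction-InD zero (suc m) H = scalD 0# unitD
  fromTypeFunction-InD (suc fuel) (suc m) H = sumElements-map-InD _ (oneTo (suc m)) λ k mk →
    mulD (genD k (proj₁ (∈-oneTo⁻ mk))) (fromTypeFunction-InD fuel (suc m ℕ.∸ k) (λ K → H (k ∷ K)))

  ≡ᵇ-∸ : ∀ a b c → a ≤ c → (b ≡ᵇ (c ℕ.∸ a)) ≡ ((a ℕ.+ b) ≡ᵇ c)
  ≡ᵇ-∸ a b c a≤c = bool-ext
    (λ e → subst (λ z → ((a ℕ.+ z) ≡ᵇ c) ≡ true) (sym (≡ᵇ-true⇒≡ b (c ℕ.∸ a) e))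
             (subst (λ z → (z ≡ᵇ c) ≡ true) (sym (ℕₚ.m+[n∸m]≡n a≤c)) (≡ᵇ-refl c)))
    (λ e → subst (λ z → (b ≡ᵇ (z ℕ.∸ a)) ≡ true) (≡ᵇ-true⇒≡ (a ℕ.+ b) c e)
             (subst (λ z → (b ≡ᵇ z) ≡ true) (sym (ℕₚ.m+n∸m≡n a b)) (≡ᵇ-refl b)))

  fromTypeFunction-val : ∀ fuel m H → m ≤ fuel → ∀ w → ValidSC w → fromTypeFunction fuel m H w ≈ ite (size w ≡ᵇ m) (H (blockSizes w))
  fromTypeFunction-val fuel zero H _ [] _ = *-identityʳ _
  fromTypeFunction-val fuel zero H _ ([] ∷ w) ((S≢[] ∷ _) , _) = ⊥-elim (proj₁ S≢[] refl)
  fromTypeFunction-val fuel zero H _ ((x ∷ S) ∷ w) _ = zeroʳ _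
  fromTypeFunction-val (suc fuel) (suc m) H (s≤s m≤) w v =
    ≈-trans (sumElements-val (map part (oneTo (suc m))) w) (≈-trans (Σ-map (oneTo (suc m)) part (λ x → x w)) (by-first-block w v))
    where
      part : ℕ → T̂
      part k = oneN k ∗ fromTypeFunction fuel (suc m ℕ.∸ k) (λ K → H (k ∷ K))
      by-first-block : ∀ w → ValidSC w → Σ[ oneTo (suc m) ] (λ k → part k w) ≈ ite (size w ≡ᵇ suc m) (H (blockSizes w))
      by-first-block [] _ = Σ-0 (oneTo (suc m)) _ (λ k _ → oneN∗-nil k (fromTypeFunction fuel (suc m ℕ.∸ k) (λ K → H (k ∷ K))))
      by-first-block ([] ∷ w) ((S≢[] ∷ _) , _) = ⊥-elim (proj₁ S≢[] refl)
      by-first-block ((x ∷ S) ∷ w) v =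
        ≈-trans (Σ-cong (oneTo (suc m)) (λ k _ → oneN∗-cons k (fromTypeFunction fuel (suc m ℕ.∸ k) (λ K → H (k ∷ K))) (x ∷ S) w)) (first-size (suc (length S) ℕₚ.≤? suc m))
        where
          L = suc (length S)
          first-size : Dec (L ≤ suc m) → Σ[ oneTo (suc m) ] (λ k → ite (L ≡ᵇ k) (fromTypeFunction fuel (suc m ℕ.∸ k) (λ K → H (k ∷ K)) w))
                                        ≈ ite (size ((x ∷ S) ∷ w) ≡ᵇ suc m) (H (blockSizes ((x ∷ S) ∷ w)))
          first-size (yes L≤) =
            ≈-trans (Σ-ite-unique (oneTo (suc m)) (L ≡ᵇ_) (λ k → fromTypeFunction fuel (suc m ℕ.∸ k) (λ K → H (k ∷ K)) w)
                       (oneTo-Unique (suc m)) (∈-oneTo⁺ (s≤s z≤n) L≤) (≡ᵇ-refl L) (λ y _ e → sym (≡ᵇ-true⇒≡ L y e)))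
            (≈-trans (fromTypeFunction-val fuel (suc m ℕ.∸ L) (λ K → H (L ∷ K)) (ℕₚ.≤-trans (ℕₚ.m∸n≤m m (length S)) m≤) w (Valid-drop 1 v))
                     (reflexive (cong (λ z → ite z (H (L ∷ blockSizes w))) (≡ᵇ-∸ L (size w) (suc m) L≤))))
          first-size (no L≰) =
            ≈-trans (Σ-ite-none (oneTo (suc m)) (L ≡ᵇ_) _ (λ k mk → ≢⇒≡ᵇ-false L k (λ e → L≰ (subst (_≤ suc m) (sym e) (proj₂ (∈-oneTo⁻ mk))))))
                    (≈-sym (ite-false _ (≢⇒≡ᵇ-false _ _ (λ e → L≰ (subst (L ≤_) e (ℕₚ.m≤m+n L (size w)))))))

  maxSize : List Term → ℕ
  maxSize [] = 0
  maxSize (t ∷ L) = sum (proj₂ t) ℕ.⊔ maxSize L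

  evalTerms-beyond-maxSize : ∀ L K → maxSize L < sum K → evalTerms L K ≈ 0#
  evalTerms-beyond-maxSize [] K _ = ≈-refl
  evalTerms-beyond-maxSize (t ∷ L) K lt =
    ≈-trans (+-cong (ite-false (proj₁ t) (≢⇒eqN-false λ { refl → ℕₚ.<-irrefl refl (ℕₚ.≤-<-trans (ℕₚ.m≤m⊔n (sum (proj₂ t)) (maxSize L)) lt) }))
                    (evalTerms-beyond-maxSize L K (ℕₚ.≤-<-trans (ℕₚ.m≤n⊔m (sum (proj₂ t)) (maxSize L)) lt)))
            (+-identityˡ 0#)

  ∘-closed : ∀ f g → InD f → InD g → InD (f ∘ g)
  ∘-closed f g df dg = respD sum≐∘ (sumElements-map-InD part sizes λ m _ → fromTypeFunction-InD m m (∘-typeFunction df dg))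
    where
      L = proj₁ (InD⇒rep df)
      r = proj₂ (InD⇒rep df)
      bound = maxSize L
      sizes = upTo (suc bound)
      part : ℕ → T̂
      part m = fromTypeFunction m m (∘-typeFunction df dg)
      by-size : ∀ w → ValidSC w → Dec (size w ≤ bound) → Σ[ sizes ] (λ m → ite (size w ≡ᵇ m) (∘-typeFunction df dg (blockSizes w))) ≈ (f ∘ g) w
      by-size w v (yes ≤bound) =
        ≈-trans (Σ-ite-unique sizes (size w ≡ᵇ_) (λ _ → ∘-typeFunction df dg (blockSizes w)) (Uniqueₚ.upTo⁺ _)
                  (∈ₚ.∈-upTo⁺ (s≤s ≤bound)) (≡ᵇ-refl (size w)) (λ y _ e → sym (≡ᵇ-true⇒≡ _ y e)))
                (≈-sym (∘-by-type df dg w v))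
      by-size w v (no >bound) =
        ≈-trans (Σ-ite-none sizes (size w ≡ᵇ_) _ (λ m mm → ≢⇒≡ᵇ-false _ _ (λ e → >bound (subst (_≤ bound) (sym e) (ℕₚ.≤-pred (∈ₚ.∈-upTo⁻ mm))))))
                (≈-sym (∘-vanishes df dg w v λ u mu → ≈-trans (r u (∈-SetComps⇒Valid {size w} mu))
                  (evalTerms-beyond-maxSize L (blockSizes u) (subst (bound <_) (sym (proj₂ (blockSizes-IsComposition {size w} mu))) (ℕₚ.≰⇒> >bound)))))
      sum≐∘ : sumElements (map part sizes) ≐ (f ∘ g)
      sum≐∘ w v = ≈-trans (sumElements-val (map part sizes) w) (≈-trans (Σ-map sizes part (λ x → x w))
                    (≈-trans (Σ-cong sizes (λ m _ → fromTypeFunction-val m m _ ℕₚ.≤-refl w v)) (by-size w v (size w ℕₚ.≤? bound))))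

  Dn-∘-closed : ∀ n f g → InDn n f → InDn n g → InDn n (f ∘ g)
  Dn-∘-closed n f g (df , f-sized) (dg , _) = ∘-closed f g df dg ,
    λ w v size≢n → ∘-vanishes df dg w v λ u mu → f-sized u (∈-SetComps⇒Valid {size w} mu) (λ e → size≢n (trans (sym (proj₂ (blockSizes-IsComposition {size w} mu))) e))

mainTheorem9 : ∀ {c ℓ} (F : Field c ℓ) → let open Construction F in
    (∀ f g → InD f → InD g → InD (f ∘ g)) ×
    (∀ n → 1 ≤ n →
      (∀ f g → InDn n f → InDn n g → InDn n (f ∘ g)) ×
      Σ (T̂ → KS) (λ φ → IsDescentIso n φ))
mainTheorem9 F = ∘-closed , λ n _ → Dn-∘-closed n , φ n , record
  { wellDefined    = λ f g _ _ → φ-cong n f g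
  ; intoDesc       = φ-InDesc n
  ; additive       = λ f g _ _ → φ-⊕ n f g
  ; homogeneous    = λ a f _ → φ-· n a f
  ; multiplicative = λ f g f∈ _ → φ-∘ n f g (proj₁ f∈)
  ; injective      = injective n
  ; surjective     = surjective n
  }
  where
    open Closure F
    open DescentMap F
    open Multiplicativity F
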